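{- Let $m,d$ be nonnegative integers with $d<q$. Let $1\le i\le |E_2|-r_2(E_2)$ and let $\sigma\subseteq E_2$ be such that $E_2\setminus\sigma$ is inclusion-minimal in $N_i$. Then there exists $\tau\subseteq E_1$ such that $E_1\setminus\tau$ is inclusion-minimal in $N_i'$ and $\tau\cap E_2=\sigma$.
   Context: Let $q$ be a prime power. $\mathrm{PRM}_q(d,m)$ is the code obtained by evaluating all homogeneous polynomials of degree $d$ in $m+1$ variables over $\mathbb{F}_q$ (including $0$) at fixed representatives of all points of $\mathbb{P}^m_q$; $\mathrm{RM}_q(d,m)$ is the code obtained by evaluating all polynomials of degree at most $d$ in $m$ variables over $\mathbb{F}_q$ at all points of $\mathbb{A}^m_q=\mathbb{F}_q^m$. Let $H\subset\mathbb{P}^m_q$ be a hyperplane $x_H=0$ and identify $\mathbb{A}^m_q=\mathbb{P}^m_q\setminus H$, choosing for its points the representatives with $x_H=1$. Let $E_1=\mathbb{P}^m_q$ and $E_2=\mathbb{A}^m_q\subseteq E_1$. Let $M_1$ (resp. $M_2$) be the parity check matroid of $\mathrm{PRM}_q(d,m)$ on $E_1$ (resp. of $\mathrm{RM}_q(d,m)$ on $E_2$), with rank functions $r_1,r_2$ and nullities $n_1(\tau)=|\tau|-r_1(\tau)$, $n_2(\sigma)=|\sigma|-r_2(\sigma)$. Set $N_i'=\{\tau\subseteq E_1: n_1(\tau)=i\}$ and $N_i=\{\sigma\subseteq E_2: n_2(\sigma)=i\}$. -}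

module Defs where

open import Level using (0ℓ)
open import Data.Nat as ℕ using (ℕ; zero; suc)
open import Data.Fin using (Fin; zero; suc)
open import Data.Fin.Subset using (Subset; _∈_; _∉_; _⊆_; ∣_∣; ∁)
open import Data.List using (List; []; _∷_)
open import Data.List.Relation.Unary.All using (All)
open import Data.Product using (Σ; ∃; _×_; _,_)
open import Relation.Binary.PropositionalEquality using (_≡_)
open import Relation.Nullary using (¬_)
open import Algebra.Structures using (IsCommutativeRing)
open import Function.Bundles using (_↔_)

record FiniteField (q : ℕ) : Set₁ where
  infixl 6 _+_
  infixl 7 _*_
  field
    Carrier : Set
    _+_ _*_ : Carrier → Carrier → Carrier
    -_      : Carrier → Carrier
    0# 1#   : Carrier
    isCommutativeRing : IsCommutativeRing _≡_ _+_ _*_ -_ 0# 1#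
    0≢1     : ¬ (0# ≡ 1#)
    inverse : ∀ x → ¬ (x ≡ 0#) → Σ Carrier (λ y → x * y ≡ 1#)
    enum    : Fin q ↔ Carrier

module FieldDefs {q : ℕ} (𝔽 : FiniteField q) where
  open FiniteField 𝔽 public

  Vect : ℕ → Set
  Vect n = Fin n → Carrier

  sumF : (n : ℕ) → (Fin n → Carrier) → Carrier
  sumF zero    f = 0#
  sumF (suc n) f = f zero + sumF n (λ i → f (suc i))

  pow : Carrier → ℕ → Carrier
  pow x zero    = 1#
  pow x (suc k) = x * pow x k

  prodF : (n : ℕ) → (Fin n → Carrier) → Carrier
  prodF zero    f = 1#
  prodF (suc n) f = f zero * prodF n (λ i → f (suc i))

  degM : {nv : ℕ} → (Fin nv → ℕ) → ℕ
  degM {zero}  e = 0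
  degM {suc n} e = e zero ℕ.+ degM {n} (λ i → e (suc i))

  Poly : ℕ → Set
  Poly nv = List (Carrier × (Fin nv → ℕ))

  evalPoly : {nv : ℕ} → Poly nv → Vect nv → Carrier
  evalPoly []            x = 0#
  evalPoly ((c , e) ∷ f) x = c * prodF _ (λ k → pow (x k) (e k)) + evalPoly f x

  Homogeneous : {nv : ℕ} → ℕ → Poly nv → Set
  Homogeneous d f = All (λ t → degM (Data.Product.proj₂ t) ≡ d) f

  DegreeAtMost : {nv : ℕ} → ℕ → Poly nv → Set
  DegreeAtMost d f = All (λ t → degM (Data.Product.proj₂ t) ℕ.≤ d) f

  Code : ℕ → Set₁
  Code n = Vect n → Set

  IsParityCheck : {n : ℕ} → Code n → (r : ℕ) → (Fin r → Vect n) → Set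
  IsParityCheck {n} C r h =
    ∀ (c : Vect n) → (C c → ∀ k → sumF n (λ i → h k i * c i) ≡ 0#)
                   × ((∀ k → sumF n (λ i → h k i * c i) ≡ 0#) → C c)

  Indep : {n r : ℕ} → (Fin r → Vect n) → Subset n → Set
  Indep {n} h T =
    ∀ (a : Vect n) → (∀ i → i ∉ T → a i ≡ 0#)
                   → (∀ k → sumF n (λ i → a i * h k i) ≡ 0#)
                   → ∀ i → a i ≡ 0#

  HasRank : {n r : ℕ} → (Fin r → Vect n) → Subset n → ℕ → Set
  HasRank h S k =
    (∃ λ T → T ⊆ S × Indep h T × ∣ T ∣ ≡ k)
    × (∀ T → T ⊆ S → Indep h T → ∣ T ∣ ℕ.≤ k)

  HasNullity : {n r : ℕ} → (Fin r → Vect n) → Subset n → ℕ → Set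
  HasNullity h S i = ∃ λ k → HasRank h S k × ∣ S ∣ ≡ k ℕ.+ i

  -- S is an inclusion-minimal element of N_i = {sets of nullity i}
  MinimalNullity : {n r : ℕ} → (Fin r → Vect n) → ℕ → Subset n → Set
  MinimalNullity h i S =
    HasNullity h S i × (∀ R → R ⊆ S → HasNullity h R i → R ≡ S)

  deleteAt : {m : ℕ} → Fin (suc m) → Vect (suc m) → Vect m
  deleteAt j x k = x (Data.Fin.punchIn j k)

  Proportional : {n : ℕ} → Vect n → Vect n → Set
  Proportional v w = ∃ λ λ' → ¬ (λ' ≡ 0#) × (∀ k → v k ≡ λ' * w k)

  NonZeroV : {n : ℕ} → Vect n → Set
  NonZeroV v = ∃ λ k → ¬ (v k ≡ 0#)

  IsProjRepresentatives : {m n₁ : ℕ} → (Fin n₁ → Vect (suc m)) → Set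
  IsProjRepresentatives {m} {n₁} pts =
    (∀ i → NonZeroV (pts i))
    × (∀ v → NonZeroV v → ∃ λ i → Proportional v (pts i)
                                × (∀ i' → Proportional v (pts i') → i' ≡ i))

  PRM : {m n₁ : ℕ} → ℕ → (Fin n₁ → Vect (suc m)) → Code n₁
  PRM {m} d pts c = ∃ λ (f : Poly (suc m)) → Homogeneous d f × (∀ i → c i ≡ evalPoly f (pts i))

  RM : {m n₂ : ℕ} → ℕ → (Fin n₂ → Vect m) → Code n₂
  RM {m} d apts c = ∃ λ (f : Poly m) → DegreeAtMost d f × (∀ i → c i ≡ evalPoly f (apts i))

-- The codewords of a code with parity-check matrix h are the linear dependencies among the columns of h,
-- so the nullity of a set S of columns is the dimension of the space of codewords supported in S; over 𝔽_q
-- it is read off by counting them. A set is inclusion-minimal of nullity i exactly when it has nullity i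
-- and is the union of the supports of the codewords it carries.
--
-- Let τ be the set of projective points at which every PRM codeword vanishing on σ vanishes. Restriction
-- to the affine chart x_H ≠ 0 is a bijection from the PRM codewords vanishing on σ onto the RM codewords
-- supported in E₂ ∖ σ: dehomogenization lands in RM, homogenization to degree d is a section, and it is
-- injective because a form f of degree d < q vanishing on the affine points vanishes at every point y at
-- infinity (t ↦ f (e_H + t y) has degree ≤ d, vanishes on all of 𝔽_q, and its coefficient of tᵈ is f y).
-- Hence E₁ ∖ τ carries q^i codewords and is the union of their supports, so it is minimal in N′_i. Finally
-- τ ∩ E₂ = σ, since each point of the minimal set E₂ ∖ σ lies in the support of an RM codeword supported
-- there, whose homogenization keeps that point out of τ.

module Submission where

open import Defs
open import Data.Nat using (ℕ; suc; _≤_; _<_; _∸_)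
open import Data.Fin using (Fin)
open import Data.Fin.Subset using (Subset; _∈_; ∁; ⊤)
open import Data.Product using (∃; _×_)
open import Relation.Binary.PropositionalEquality using (_≡_)
open import Relation.Nullary using (¬_)
open import Function.Definitions using (Injective)

open import Level using (0ℓ)
open import Data.Nat using (zero; z≤n; s≤s)
open import Data.Fin using (zero; suc)
open import Data.Bool using (Bool; true; false; T; if_then_else_)
open import Data.Unit using (tt)
open import Data.Empty using (⊥-elim)
open import Data.Product using (_,_)
open import Function using (_∘_; id)
open import Algebra.Bundles using (CommutativeRing)
open import Relation.Binary.PropositionalEquality
  using (refl; sym; trans; cong; cong₂; subst; _≢_; module ≡-Reasoning)

module FinCount where

  open import Data.Nat.Properties using (≤-trans; n≤1+n; <-irrefl)
  open import Data.Fin.Properties using (injective⇒≤; suc-injective)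

  count : (N : ℕ) → (Fin N → Bool) → ℕ
  count zero    P = 0
  count (suc N) P = (if P zero then suc else id) (count N (P ∘ suc))

  -- select enumerates the x with T (P x) in increasing order; index is its inverse.
  select : (N : ℕ) (P : Fin N → Bool) → Fin (count N P) → Fin N
  select (suc N) P with P zero
  ... | true  = λ { zero → zero ; (suc j) → suc (select N (P ∘ suc) j) }
  ... | false = suc ∘ select N (P ∘ suc)

  select-satisfies : ∀ N P (j : Fin (count N P)) → T (P (select N P j))
  select-satisfies (suc N) P with P zero in eq
  ... | true  = λ { zero → subst T (sym eq) tt ; (suc j) → select-satisfies N (P ∘ suc) j }
  ... | false = select-satisfies N (P ∘ suc)

  select-injective : ∀ N P (i j : Fin (count N P)) → select N P i ≡ select N P j → i ≡ j
  select-injective (suc N) P with P zero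
  ... | true  = λ { zero zero _ → refl ; zero (suc j) () ; (suc i) zero ()
                  ; (suc i) (suc j) e → cong suc (select-injective N (P ∘ suc) i j (suc-injective e)) }
  ... | false = λ i j e → select-injective N (P ∘ suc) i j (suc-injective e)

  index : ∀ N (P : Fin N → Bool) (x : Fin N) → T (P x) → Fin (count N P)
  index (suc N) P zero with P zero
  ... | true  = λ _ → zero
  ... | false = λ ()
  index (suc N) P (suc x) with P zero
  ... | true  = suc ∘ index N (P ∘ suc) x
  ... | false = index N (P ∘ suc) x

  index-injective : ∀ N P (x y : Fin N) (px : T (P x)) (py : T (P y)) →
                    index N P x px ≡ index N P y py → x ≡ y
  index-injective (suc N) P zero zero px py e = refl
  index-injective (suc N) P zero (suc y) with P zero
  ... | true  = λ _ _ ()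
  ... | false = λ ()
  index-injective (suc N) P (suc x) zero with P zero
  ... | true  = λ _ _ ()
  ... | false = λ _ ()
  index-injective (suc N) P (suc x) (suc y) with P zero
  ... | true  = λ px py e → cong suc (index-injective N (P ∘ suc) x y px py (suc-injective e))
  ... | false = λ px py e → cong suc (index-injective N (P ∘ suc) x y px py e)

  count-≤-injection : ∀ N M (P : Fin N → Bool) (Q : Fin M → Bool) (f : Fin N → Fin M) →
                      (∀ x → T (P x) → T (Q (f x))) →
                      (∀ x y → T (P x) → T (P y) → f x ≡ f y → x ≡ y) →
                      count N P ≤ count M Q
  count-≤-injection N M P Q f PQ f-inj = injective⇒≤ {f = g} g-injective
    where
    g : Fin (count N P) → Fin (count M Q)
    g j = index M Q (f (select N P j)) (PQ _ (select-satisfies N P j))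
    g-injective : ∀ {i j} → g i ≡ g j → i ≡ j
    g-injective {i} {j} e = select-injective N P i j
      (f-inj _ _ (select-satisfies N P i) (select-satisfies N P j) (index-injective M Q _ _ _ _ e))

  count-all : ∀ N (P : Fin N → Bool) → (∀ x → T (P x)) → count N P ≡ N
  count-all zero    P _   = refl
  count-all (suc N) P all with P zero | all zero
  ... | true | _ = cong suc (count-all N (P ∘ suc) (all ∘ suc))

  count-mono : ∀ N (P Q : Fin N → Bool) → (∀ x → T (P x) → T (Q x)) → count N P ≤ count N Q
  count-mono N P Q PQ = count-≤-injection N N P Q id PQ (λ _ _ _ _ e → e)

  count-strict-mono : ∀ N (P Q : Fin N → Bool) → (∀ x → T (P x) → T (Q x)) →
                      ∀ x → T (Q x) → ¬ T (P x) → suc (count N P) ≤ count N Q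
  count-strict-mono (suc N) P Q PQ zero with P zero | Q zero | PQ zero
  ... | true  | _     | _ = λ _ ¬p → ⊥-elim (¬p tt)
  ... | false | true  | _ = λ _ _ → s≤s (count-mono N (P ∘ suc) (Q ∘ suc) (PQ ∘ suc))
  ... | false | false | _ = λ ()
  count-strict-mono (suc N) P Q PQ (suc x) with P zero | Q zero | PQ zero
  ... | true  | true  | _  = λ q ¬p → s≤s (count-strict-mono N (P ∘ suc) (Q ∘ suc) (PQ ∘ suc) x q ¬p)
  ... | true  | false | pq = ⊥-elim (pq tt)
  ... | false | true  | _  = λ q ¬p →
    ≤-trans (count-strict-mono N (P ∘ suc) (Q ∘ suc) (PQ ∘ suc) x q ¬p) (n≤1+n _)
  ... | false | false | _  = count-strict-mono N (P ∘ suc) (Q ∘ suc) (PQ ∘ suc) x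

  count-≡⇒⊇ : ∀ N (P Q : Fin N → Bool) → (∀ x → T (P x) → T (Q x)) →
              count N P ≡ count N Q → ∀ x → T (Q x) → T (P x)
  count-≡⇒⊇ N P Q PQ e x q with P x in eq
  ... | true  = tt
  ... | false = ⊥-elim (<-irrefl e (count-strict-mono N P Q PQ x q (subst T eq)))

module FieldProperties {q : ℕ} (𝔽 : FiniteField q) where

  open import Data.Nat using (_^_)
  import Data.Nat.Properties as ℕ
  open import Data.Nat.Properties using (≤-antisym)
  open import Data.Fin using (combine; remQuot)
  import Data.Fin.Properties as Fin
  open import Data.Fin.Subset using (_∉_; ∣_∣)
  open import Data.Product using (proj₁; proj₂)
  open import Data.Unit using () renaming (⊤ to Unit)
  open import Data.Vec using ([]; _∷_; here; there)
  open import Data.Vec.Functional using () renaming (_∷_ to cons)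
  open import Relation.Nullary using (Dec; yes; no)
  open import Relation.Nullary.Decidable using (¬?; _×-dec_; isYes; toWitness; fromWitness)
  open import Function.Bundles using (Inverse)
  open import Algebra.Structures using (IsCommutativeRing)

  open FieldDefs 𝔽 public
  open IsCommutativeRing isCommutativeRing public
    using ( +-assoc; +-comm; +-identityˡ; +-identityʳ; -‿inverseʳ; -‿inverseˡ
          ; *-assoc; *-comm; *-identityˡ; *-identityʳ; distribˡ; distribʳ; zeroˡ; zeroʳ )

  commutativeRing : CommutativeRing _ _
  commutativeRing = record { isCommutativeRing = isCommutativeRing }

  open import Algebra.Properties.Ring (CommutativeRing.ring commutativeRing) public
    using (-‿distribˡ-*; -0#≈0#; -‿+-comm)
    renaming (x∙y⁻¹≈ε⇒x≈y to x-y≡0⇒x≡y)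
  open import Algebra.Properties.CommutativeSemigroup
    (CommutativeRing.+-commutativeSemigroup commutativeRing) public
    using () renaming (interchange to +-interchange)
  open import Algebra.Properties.CommutativeSemigroup
    (CommutativeRing.*-commutativeSemigroup commutativeRing) public
    using () renaming (interchange to *-interchange; x∙yz≈y∙xz to *-left-commute)

  open ≡-Reasoning

  toF : Fin q → Carrier
  toF = Inverse.to enum

  fromF : Carrier → Fin q
  fromF = Inverse.from enum

  toF-fromF : ∀ x → toF (fromF x) ≡ x
  toF-fromF = Inverse.strictlyInverseˡ enum

  fromF-toF : ∀ i → fromF (toF i) ≡ i
  fromF-toF = Inverse.strictlyInverseʳ enum

  toF-injective : ∀ {i j} → toF i ≡ toF j → i ≡ j
  toF-injective {i} {j} e = trans (sym (fromF-toF i)) (trans (cong fromF e) (fromF-toF j))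

  fromF-injective : ∀ {x y} → fromF x ≡ fromF y → x ≡ y
  fromF-injective {x} {y} e = trans (sym (toF-fromF x)) (trans (cong toF e) (toF-fromF y))

  infix 4 _≟_
  _≟_ : (x y : Carrier) → Dec (x ≡ y)
  x ≟ y with fromF x Fin.≟ fromF y
  ... | yes e = yes (fromF-injective e)
  ... | no ne = no (ne ∘ cong fromF)

  2≤q : 2 ≤ q
  2≤q = Fin.injective⇒≤ {f = f} f-injective
    where
    f : Fin 2 → Fin q
    f zero    = fromF 0#
    f (suc _) = fromF 1#
    f-injective : ∀ {i j} → f i ≡ f j → i ≡ j
    f-injective {zero}     {zero}     _ = refl
    f-injective {zero}     {suc zero} e = ⊥-elim (0≢1 (fromF-injective e))
    f-injective {suc zero} {zero}     e = ⊥-elim (0≢1 (sym (fromF-injective e)))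
    f-injective {suc zero} {suc zero} _ = refl

  q^-reflects-≤ : ∀ {a b} → q ^ a ≤ q ^ b → a ≤ b
  q^-reflects-≤ {a} {b} q^a≤q^b with a ℕ.≤? b
  ... | yes a≤b = a≤b
  ... | no  a≰b = ⊥-elim (ℕ.<⇒≱ (ℕ.^-monoʳ-< q 2≤q (ℕ.≰⇒> a≰b)) q^a≤q^b)

  q^-injective : ∀ {a b} → q ^ a ≡ q ^ b → a ≡ b
  q^-injective e = ℕ.≤-antisym (q^-reflects-≤ (ℕ.≤-reflexive e)) (q^-reflects-≤ (ℕ.≤-reflexive (sym e)))

  xy≡0⇒y≡0 : ∀ {x y} → ¬ x ≡ 0# → x * y ≡ 0# → y ≡ 0#
  xy≡0⇒y≡0 {x} {y} x≢0 xy≡0 with inverse x x≢0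
  ... | x⁻¹ , xx⁻¹≡1 = begin
    y              ≡⟨ sym (*-identityˡ y) ⟩
    1# * y         ≡⟨ cong (_* y) (trans (sym xx⁻¹≡1) (*-comm x x⁻¹)) ⟩
    (x⁻¹ * x) * y  ≡⟨ *-assoc x⁻¹ x y ⟩
    x⁻¹ * (x * y)  ≡⟨ cong (x⁻¹ *_) xy≡0 ⟩
    x⁻¹ * 0#       ≡⟨ zeroʳ x⁻¹ ⟩
    0#             ∎

  sumF-cong : ∀ n {f g : Fin n → Carrier} → (∀ i → f i ≡ g i) → sumF n f ≡ sumF n g
  sumF-cong zero    e = refl
  sumF-cong (suc n) e = cong₂ _+_ (e zero) (sumF-cong n (e ∘ suc))

  sumF-zero : ∀ n {f : Fin n → Carrier} → (∀ i → f i ≡ 0#) → sumF n f ≡ 0#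
  sumF-zero zero    e = refl
  sumF-zero (suc n) e = trans (cong₂ _+_ (e zero) (sumF-zero n (e ∘ suc))) (+-identityˡ 0#)

  sumF-+ : ∀ n (f g : Fin n → Carrier) → sumF n (λ i → f i + g i) ≡ sumF n f + sumF n g
  sumF-+ zero    f g = sym (+-identityˡ 0#)
  sumF-+ (suc n) f g =
    trans (cong (f zero + g zero +_) (sumF-+ n (f ∘ suc) (g ∘ suc))) (+-interchange _ _ _ _)

  sumF-neg : ∀ n (f : Fin n → Carrier) → sumF n (λ i → - f i) ≡ - sumF n f
  sumF-neg zero    f = sym -0#≈0#
  sumF-neg (suc n) f = trans (cong (- f zero +_) (sumF-neg n (f ∘ suc))) (-‿+-comm _ _)

  sumF-*ˡ : ∀ n c (f : Fin n → Carrier) → sumF n (λ i → c * f i) ≡ c * sumF n f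
  sumF-*ˡ zero    c f = sym (zeroʳ c)
  sumF-*ˡ (suc n) c f = trans (cong (c * f zero +_) (sumF-*ˡ n c (f ∘ suc))) (sym (distribˡ c _ _))

  sumF-*ʳ : ∀ n (f : Fin n → Carrier) c → sumF n f * c ≡ sumF n (λ i → f i * c)
  sumF-*ʳ n f c = trans (*-comm _ c) (trans (sym (sumF-*ˡ n c f)) (sumF-cong n (λ i → *-comm c (f i))))

  sumF-swap : ∀ n m (f : Fin n → Fin m → Carrier) →
              sumF n (λ i → sumF m (f i)) ≡ sumF m (λ j → sumF n (λ i → f i j))
  sumF-swap zero    m f = sym (sumF-zero m (λ _ → refl))
  sumF-swap (suc n) m f = trans (cong (sumF m (f zero) +_) (sumF-swap n m (f ∘ suc)))
    (sym (sumF-+ m (f zero) (λ j → sumF n (λ i → f (suc i) j))))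

  sumF-single : ∀ n (f : Fin n → Carrier) i → (∀ j → ¬ j ≡ i → f j ≡ 0#) → sumF n f ≡ f i
  sumF-single (suc n) f zero    e =
    trans (cong (f zero +_) (sumF-zero n (λ j → e (suc j) λ ()))) (+-identityʳ _)
  sumF-single (suc n) f (suc i) e = trans (cong (_+ sumF n (f ∘ suc)) (e zero λ ()))
    (trans (+-identityˡ _) (sumF-single n (f ∘ suc) i (λ j j≢i → e (suc j) (j≢i ∘ Fin.suc-injective))))

  infix 4 _≈V_
  _≈V_ : ∀ {n} → Vect n → Vect n → Set
  v ≈V w = ∀ i → v i ≡ w i

  -- F^n is enumerated by Fin (q ^ n), so properties of vectors can be counted and searched.
  encode : ∀ n → Vect n → Fin (q ^ n)
  encode zero    v = zero
  encode (suc n) v = combine (fromF (v zero)) (encode n (v ∘ suc))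

  decode : ∀ n → Fin (q ^ n) → Vect n
  decode (suc n) x = cons (toF (proj₁ (remQuot {q} (q ^ n) x))) (decode n (proj₂ (remQuot {q} (q ^ n) x)))

  decode-encode : ∀ n (v : Vect n) → decode n (encode n v) ≈V v
  decode-encode (suc n) v i =
    trans (cong (λ p → cons (toF (proj₁ p)) (decode n (proj₂ p)) i) split) (tail i)
    where
    split : remQuot {q} (q ^ n) (encode (suc n) v) ≡ (fromF (v zero) , encode n (v ∘ suc))
    split = Fin.remQuot-combine {q} {q ^ n} (fromF (v zero)) (encode n (v ∘ suc))
    tail : cons (toF (fromF (v zero))) (decode n (encode n (v ∘ suc))) ≈V v
    tail zero     = toF-fromF (v zero)
    tail (suc i′) = decode-encode n (v ∘ suc) i′

  encode-cong : ∀ n {v w : Vect n} → v ≈V w → encode n v ≡ encode n w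
  encode-cong zero    e = refl
  encode-cong (suc n) e = cong₂ combine (cong fromF (e zero)) (encode-cong n (e ∘ suc))

  encode-injective : ∀ n {v w : Vect n} → encode n v ≡ encode n w → v ≈V w
  encode-injective n {v} {w} e i =
    trans (sym (decode-encode n v i)) (trans (cong (λ x → decode n x i) e) (decode-encode n w i))

  encode-decode : ∀ n (x : Fin (q ^ n)) → encode n (decode n x) ≡ x
  encode-decode zero    zero = refl
  encode-decode (suc n) x =
    trans (cong₂ combine (fromF-toF _) (encode-decode n _)) (Fin.combine-remQuot {q} (q ^ n) x)

  compress : ∀ {m} (U : Subset m) → Vect m → Vect ∣ U ∣
  compress []          v ()
  compress (true ∷ U)  v = cons (v zero) (compress U (v ∘ suc))
  compress (false ∷ U) v = compress U (v ∘ suc)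

  expand : ∀ {m} (U : Subset m) → Vect ∣ U ∣ → Vect m
  expand (true ∷ U)  w zero    = w zero
  expand (true ∷ U)  w (suc i) = expand U (w ∘ suc) i
  expand (false ∷ U) w zero    = 0#
  expand (false ∷ U) w (suc i) = expand U w i

  expand-∉ : ∀ {m} (U : Subset m) w i → i ∉ U → expand U w i ≡ 0#
  expand-∉ (true ∷ U)  w zero    i∉U = ⊥-elim (i∉U here)
  expand-∉ (true ∷ U)  w (suc i) i∉U = expand-∉ U (w ∘ suc) i (i∉U ∘ there)
  expand-∉ (false ∷ U) w zero    i∉U = refl
  expand-∉ (false ∷ U) w (suc i) i∉U = expand-∉ U w i (i∉U ∘ there)

  expand-compress : ∀ {m} (U : Subset m) v i → i ∈ U → expand U (compress U v) i ≡ v i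
  expand-compress (true ∷ U)  v zero    _           = refl
  expand-compress (true ∷ U)  v (suc i) (there i∈U) = expand-compress U (v ∘ suc) i i∈U
  expand-compress (false ∷ U) v (suc i) (there i∈U) = expand-compress U (v ∘ suc) i i∈U

  compress-expand : ∀ {m} (U : Subset m) w → compress U (expand U w) ≈V w
  compress-expand (true ∷ U)  w zero    = refl
  compress-expand (true ∷ U)  w (suc i) = compress-expand U (w ∘ suc) i
  compress-expand (false ∷ U) w i       = compress-expand U w i

  expand-cong : ∀ {m} (U : Subset m) {w w′} → w ≈V w′ → expand U w ≈V expand U w′
  expand-cong (true ∷ U)  e zero    = e zero
  expand-cong (true ∷ U)  e (suc i) = expand-cong U (e ∘ suc) i
  expand-cong (false ∷ U) e zero    = refl
  expand-cong (false ∷ U) e (suc i) = expand-cong U e i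

  compress-cong : ∀ {m} (U : Subset m) {v v′} → v ≈V v′ → compress U v ≈V compress U v′
  compress-cong (true ∷ U)  e zero    = e zero
  compress-cong (true ∷ U)  e (suc i) = compress-cong U (e ∘ suc) i
  compress-cong (false ∷ U) e i       = compress-cong U (e ∘ suc) i

  -- Without function extensionality, properties of vectors must be closed under pointwise equality.
  record VecPred (n : ℕ) : Set₁ where
    field
      Holds    : Vect n → Set
      holds?   : ∀ v → Dec (Holds v)
      respects : ∀ {v w} → v ≈V w → Holds v → Holds w

  open VecPred public

  everything : ∀ n → VecPred n
  everything n = record { Holds = λ _ → Unit ; holds? = λ _ → yes tt ; respects = λ _ _ → tt }

  count : ∀ {n} → VecPred n → ℕ
  count {n} P = FinCount.count (q ^ n) (λ x → isYes (holds? P (decode n x)))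

  private
    fromT : ∀ {n} (P : VecPred n) {v} → T (isYes (holds? P v)) → Holds P v
    fromT P {v} = toWitness {a? = holds? P v}

    toT : ∀ {n} (P : VecPred n) {v} → Holds P v → T (isYes (holds? P v))
    toT P {v} = fromWitness {a? = holds? P v}

    holds-decode-encode : ∀ {n} (P : VecPred n) {v} → Holds P v → Holds P (decode n (encode n v))
    holds-decode-encode {n} P {v} = respects P (λ i → sym (decode-encode n v i))

  count-≤-injection : ∀ {a b} (P : VecPred a) (Q : VecPred b) (f : Vect a → Vect b) →
    (∀ v → Holds P v → Holds Q (f v)) →
    (∀ v w → Holds P v → Holds P w → f v ≈V f w → v ≈V w) →
    count P ≤ count Q
  count-≤-injection {a} {b} P Q f PQ f-inj =
    FinCount.count-≤-injection (q ^ a) (q ^ b) _ _ (encode b ∘ f ∘ decode a)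
      (λ x px → toT Q (holds-decode-encode Q (PQ _ (fromT P px))))
      (λ x y px py e → begin
        x                      ≡⟨ sym (encode-decode a x) ⟩
        encode a (decode a x)  ≡⟨ encode-cong a (f-inj _ _ (fromT P px) (fromT P py) (encode-injective b e)) ⟩
        encode a (decode a y)  ≡⟨ encode-decode a y ⟩
        y                      ∎)

  count-everything : ∀ n → count (everything n) ≡ q ^ n
  count-everything n = FinCount.count-all (q ^ n) _ (λ _ → tt)

  count-cong : ∀ {n} (P Q : VecPred n) →
               (∀ v → Holds P v → Holds Q v) → (∀ v → Holds Q v → Holds P v) → count P ≡ count Q
  count-cong P Q PQ QP = ≤-antisym (count-≤-injection P Q id PQ (λ _ _ _ _ e → e))
                                   (count-≤-injection Q P id QP (λ _ _ _ _ e → e))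

  count-≡⇒⊇ : ∀ {n} (P Q : VecPred n) → (∀ v → Holds P v → Holds Q v) →
              count P ≡ count Q → ∀ v → Holds Q v → Holds P v
  count-≡⇒⊇ {n} P Q PQ e v qv = respects P (decode-encode n v)
    (fromT P (FinCount.count-≡⇒⊇ (q ^ n) _ _ (λ x px → toT Q (PQ _ (fromT P px))) e (encode n v)
      (toT Q (holds-decode-encode Q qv))))

  _nonzeroAt_ : ∀ {n} → VecPred n → Fin n → VecPred n
  P nonzeroAt j = record
    { Holds    = λ c → Holds P c × ¬ c j ≡ 0#
    ; holds?   = λ c → holds? P c ×-dec ¬? (c j ≟ 0#)
    ; respects = λ { v≈w (pv , vj≢0) → respects P v≈w pv , vj≢0 ∘ trans (v≈w j) }
    }

  vanishes-without-witness : ∀ {n} (P : VecPred n) {j} →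
                             ¬ ∃ (Holds (P nonzeroAt j)) → ∀ c → Holds P c → c j ≡ 0#
  vanishes-without-witness P {j} none c pc with c j ≟ 0#
  ... | yes cj≡0 = cj≡0
  ... | no cj≢0  = ⊥-elim (none (c , pc , cj≢0))

  search : ∀ {n} (P : VecPred n) → Dec (∃ (Holds P))
  search {n} P with Fin.any? (λ x → holds? P (decode n x))
  ... | yes (x , px) = yes (decode n x , px)
  ... | no none      = no λ (v , pv) → none (encode n v , holds-decode-encode P pv)

module SubsetProperties where

  open import Data.Nat using (_+_)
  open import Data.Nat.Properties using (+-suc)
  open import Data.Fin.Subset using (_∉_; _⊆_; _─_; ∣_∣)
  open import Data.Fin.Subset.Properties using (drop-∷-⊆)
  open import Data.Vec using ([]; _∷_; here; there; tabulate; lookup)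
  open import Data.Vec.Properties using (lookup∘tabulate; lookup⇒[]=; []=⇒lookup)
  open import Relation.Nullary using (Dec; does)
  open import Relation.Nullary.Decidable using (dec-true; dec-false; decidable-stable)
  open import Function using (case_of_)

  module _ {n} {P : Fin n → Set} (P? : ∀ j → Dec (P j)) where

    fromPredicate : Subset n
    fromPredicate = tabulate (does ∘ P?)

    private
      lookup-fromPredicate : ∀ j → lookup fromPredicate j ≡ does (P? j)
      lookup-fromPredicate = lookup∘tabulate (does ∘ P?)

    ∈fromPredicate⁺ : ∀ {j} → P j → j ∈ fromPredicate
    ∈fromPredicate⁺ {j} pj = lookup⇒[]= j _ (trans (lookup-fromPredicate j) (dec-true (P? j) pj))

    ∈fromPredicate⁻ : ∀ {j} → j ∈ fromPredicate → P j
    ∈fromPredicate⁻ {j} j∈ = decidable-stable (P? j) λ ¬pj →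
      case trans (sym (dec-false (P? j) ¬pj)) (trans (sym (lookup-fromPredicate j)) ([]=⇒lookup j∈)) of λ ()

  x∈p─q⇒x∉q : ∀ {n} (p q : Subset n) {x} → x ∈ p ─ q → x ∉ q
  x∈p─q⇒x∉q (true ∷ p)  (false ∷ q) here      = λ ()
  x∈p─q⇒x∉q (true ∷ p)  (true ∷ q)  {zero} ()
  x∈p─q⇒x∉q (false ∷ p) (true ∷ q)  {zero} ()
  x∈p─q⇒x∉q (false ∷ p) (false ∷ q) {zero} ()
  x∈p─q⇒x∉q (_ ∷ p)     (_ ∷ q)     (there m) = λ { (there x∈q) → x∈p─q⇒x∉q p q m x∈q }

  ∣p∣≡∣p─q∣+∣q∣ : ∀ {n} (p q : Subset n) → q ⊆ p → ∣ p ∣ ≡ ∣ p ─ q ∣ + ∣ q ∣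
  ∣p∣≡∣p─q∣+∣q∣ []          []          _   = refl
  ∣p∣≡∣p─q∣+∣q∣ (true ∷ p)  (true ∷ q)  q⊆p =
    trans (cong suc (∣p∣≡∣p─q∣+∣q∣ p q (drop-∷-⊆ q⊆p))) (sym (+-suc _ _))
  ∣p∣≡∣p─q∣+∣q∣ (true ∷ p)  (false ∷ q) q⊆p = cong suc (∣p∣≡∣p─q∣+∣q∣ p q (drop-∷-⊆ q⊆p))
  ∣p∣≡∣p─q∣+∣q∣ (false ∷ p) (true ∷ q)  q⊆p with q⊆p here
  ... | ()
  ∣p∣≡∣p─q∣+∣q∣ (false ∷ p) (false ∷ q) q⊆p = ∣p∣≡∣p─q∣+∣q∣ p q (drop-∷-⊆ q⊆p)

module VectorMatroid {q : ℕ} (𝔽 : FiniteField q) {n r : ℕ} (h : Fin r → FieldDefs.Vect 𝔽 n) where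

  open import Data.Nat using (_^_) renaming (_+_ to _+ℕ_)
  import Data.Nat.Properties as ℕ
  import Data.Fin.Properties as Fin
  open import Data.Fin.Subset using (_∉_; _⊆_; ∣_∣; _∪_; _─_; ⁅_⁆; ⊥)
  open import Data.Fin.Subset.Properties
    using (_∈?_; x∈p∪q⁻; x∈p∪q⁺; x∈⁅x⁆; x∈⁅y⁆⇒x≡y; x≢y⇒x∉⁅y⁆; ∉⊥; ⊆-antisym; p─q⊆p; x∈p∧x∉q⇒x∈p─q)
  open import Data.List using (List; []; _∷_; allFin)
  open import Data.List.Membership.Propositional using () renaming (_∈_ to _∈ₗ_)
  open import Data.List.Membership.Propositional.Properties using (∈-allFin)
  open import Data.List.Relation.Unary.Any using (here; there)
  open import Data.Product using (proj₁; proj₂)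
  open import Data.Sum using (_⊎_; inj₁; inj₂; [_,_])
  open import Relation.Nullary using (Dec; yes; no)
  open import Relation.Nullary.Decidable using (¬?; _×-dec_; _→-dec_)
  open FieldProperties 𝔽
  open SubsetProperties
  open ≡-Reasoning

  Codeword : Vect n → Set
  Codeword c = ∀ k → sumF n (λ i → c i * h k i) ≡ 0#

  SupportedIn : Subset n → Vect n → Set
  SupportedIn S c = ∀ i → i ∉ S → c i ≡ 0#

  codeword? : ∀ c → Dec (Codeword c)
  codeword? c = Fin.all? (λ k → sumF n (λ i → c i * h k i) ≟ 0#)

  supportedIn? : ∀ S c → Dec (SupportedIn S c)
  supportedIn? S c = Fin.all? (λ i → ¬? (i ∈? S) →-dec (c i ≟ 0#))

  parityCheck⇒codeword : ∀ {C} → IsParityCheck C r h → ∀ c → C c → Codeword c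
  parityCheck⇒codeword isPC c Cc k =
    trans (sumF-cong n (λ i → *-comm (c i) (h k i))) (proj₁ (isPC c) Cc k)

  codeword⇒parityCheck : ∀ {C} → IsParityCheck C r h → ∀ c → Codeword c → C c
  codeword⇒parityCheck isPC c cc =
    proj₂ (isPC c) λ k → trans (sumF-cong n (λ i → *-comm (h k i) (c i))) (cc k)

  codeword-cong : ∀ {v w} → v ≈V w → Codeword v → Codeword w
  codeword-cong v≈w cv k = trans (sym (sumF-cong n (λ i → cong (_* h k i) (v≈w i)))) (cv k)

  supportedIn-cong : ∀ {S v w} → v ≈V w → SupportedIn S v → SupportedIn S w
  supportedIn-cong v≈w sv i i∉S = trans (sym (v≈w i)) (sv i i∉S)

  codewordsIn : Subset n → VecPred n
  codewordsIn S = record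
    { Holds    = λ c → Codeword c × SupportedIn S c
    ; holds?   = λ c → codeword? c ×-dec supportedIn? S c
    ; respects = λ { v≈w (cv , sv) → codeword-cong v≈w cv , supportedIn-cong v≈w sv }
    }

  codeword-zero : Codeword (λ _ → 0#)
  codeword-zero k = sumF-zero n (λ i → zeroˡ _)

  codeword-sub : ∀ {c c′} → Codeword c → Codeword c′ → Codeword (λ i → c i + - c′ i)
  codeword-sub {c} {c′} cc cc′ k = begin
    sumF n (λ i → (c i + - c′ i) * h k i)
      ≡⟨ sumF-cong n (λ i → trans (distribʳ (h k i) (c i) (- c′ i))
                                  (cong (c i * h k i +_) (sym (-‿distribˡ-* (c′ i) (h k i))))) ⟩
    sumF n (λ i → c i * h k i + - (c′ i * h k i))
      ≡⟨ sumF-+ n _ _ ⟩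
    sumF n (λ i → c i * h k i) + sumF n (λ i → - (c′ i * h k i))
      ≡⟨ cong₂ _+_ (cc k) (trans (sumF-neg n _) (trans (cong -_ (cc′ k)) -0#≈0#)) ⟩
    0# + 0#
      ≡⟨ +-identityˡ 0# ⟩
    0# ∎

  codeword-scale : ∀ a {c} → Codeword c → Codeword (λ i → a * c i)
  codeword-scale a {c} cc k = begin
    sumF n (λ i → (a * c i) * h k i) ≡⟨ sumF-cong n (λ i → *-assoc a (c i) (h k i)) ⟩
    sumF n (λ i → a * (c i * h k i)) ≡⟨ sumF-*ˡ n a _ ⟩
    a * sumF n (λ i → c i * h k i)   ≡⟨ cong (a *_) (cc k) ⟩
    a * 0#                           ≡⟨ zeroʳ a ⟩
    0#                               ∎

  codeword-combination : ∀ {m} (w : Vect m) (c : Fin m → Vect n) → (∀ j → Codeword (c j)) →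
                         Codeword (λ i → sumF m (λ j → w j * c j i))
  codeword-combination {m} w c cc k = begin
    sumF n (λ i → sumF m (λ j → w j * c j i) * h k i)
      ≡⟨ sumF-cong n (λ i → trans (sumF-*ʳ m _ (h k i)) (sumF-cong m (λ j → *-assoc _ _ _))) ⟩
    sumF n (λ i → sumF m (λ j → w j * (c j i * h k i)))
      ≡⟨ sumF-swap n m _ ⟩
    sumF m (λ j → sumF n (λ i → w j * (c j i * h k i)))
      ≡⟨ sumF-zero m (λ j → trans (sumF-*ˡ n _ _) (trans (cong (w j *_) (cc j k)) (zeroʳ _))) ⟩
    0# ∎

  independent? : ∀ T → Dec (Indep h T)
  independent? T with Fin.all? (λ j → ¬? (search ((codewordsIn T) nonzeroAt j)))
  ... | yes none = yes λ a sa ca j → vanishes-without-witness (codewordsIn T) (none j) a (ca , sa)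
  ... | no some  = no λ ind → some λ j (c , (cc , sc) , cj≢0) → cj≢0 (ind c sc cc j)

  fundamentalCircuit : ∀ T j → Indep h T → ¬ Indep h (T ∪ ⁅ j ⁆) →
                       ∃ λ c → Codeword c × SupportedIn (T ∪ ⁅ j ⁆) c × c j ≡ 1#
  fundamentalCircuit T j ind dep with search ((codewordsIn (T ∪ ⁅ j ⁆)) nonzeroAt j)
  ... | yes (c , (cc , sc) , cj≢0) with inverse (c j) cj≢0
  ...   | a , cj*a≡1 = (λ i → a * c i) , codeword-scale a cc
                     , (λ i i∉ → trans (cong (a *_) (sc i i∉)) (zeroʳ a))
                     , trans (*-comm a (c j)) cj*a≡1
  fundamentalCircuit T j ind dep | no none = ⊥-elim (dep λ c sc cc → ind c (supportedIn-T c sc cc) cc)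
    where
    supportedIn-T : ∀ c → SupportedIn (T ∪ ⁅ j ⁆) c → Codeword c → SupportedIn T c
    supportedIn-T c sc cc i i∉T with i Fin.≟ j
    ... | yes refl = vanishes-without-witness (codewordsIn (T ∪ ⁅ j ⁆)) none c (cc , sc)
    ... | no i≢j   = sc i ([ i∉T , x≢y⇒x∉⁅y⁆ i≢j ] ∘ x∈p∪q⁻ T ⁅ j ⁆)

  record IsBasis (S B : Subset n) : Set where
    field
      B⊆S         : B ⊆ S
      independent : Indep h B
      circuit     : ∀ j → j ∈ S ─ B → ∃ λ c → Codeword c × SupportedIn (B ∪ ⁅ j ⁆) c × c j ≡ 1#

  private
    record IndependentIn (S B : Subset n) : Set where
      field
        B⊆S         : B ⊆ S
        independent : Indep h B

    NotAddable : Subset n → Subset n → Fin n → Set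
    NotAddable S B j = j ∈ B ⊎ j ∉ S ⊎ ¬ Indep h (B ∪ ⁅ j ⁆)

    ∪-monoˡ : ∀ {B B′} (C : Subset n) → B ⊆ B′ → B ∪ C ⊆ B′ ∪ C
    ∪-monoˡ {B} C B⊆B′ x∈ = [ x∈p∪q⁺ ∘ inj₁ ∘ B⊆B′ , x∈p∪q⁺ ∘ inj₂ ] (x∈p∪q⁻ B C x∈)

    notAddable-mono : ∀ {S B B′} → B ⊆ B′ → ∀ j → NotAddable S B j → NotAddable S B′ j
    notAddable-mono B⊆B′ j (inj₁ j∈B)         = inj₁ (B⊆B′ j∈B)
    notAddable-mono B⊆B′ j (inj₂ (inj₁ j∉S))  = inj₂ (inj₁ j∉S)
    notAddable-mono B⊆B′ j (inj₂ (inj₂ dep))  =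
      inj₂ (inj₂ λ ind → dep (λ a sa → ind a (λ i i∉ → sa i (i∉ ∘ ∪-monoˡ ⁅ j ⁆ B⊆B′))))

    add : Subset n → Subset n → Fin n → Subset n
    add S B j with j ∈? S | independent? (B ∪ ⁅ j ⁆)
    ... | yes _ | yes _ = B ∪ ⁅ j ⁆
    ... | _     | _     = B

    add-⊇ : ∀ S B j → B ⊆ add S B j
    add-⊇ S B j with j ∈? S | independent? (B ∪ ⁅ j ⁆)
    ... | yes _ | yes _ = x∈p∪q⁺ ∘ inj₁
    ... | yes _ | no _  = id
    ... | no _  | _     = id

    add-spec : ∀ S B j → IndependentIn S B → IndependentIn S (add S B j) × NotAddable S (add S B j) j
    add-spec S B j inS with j ∈? S | independent? (B ∪ ⁅ j ⁆)
    ... | yes j∈S | yes ind =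
      record { B⊆S = [ IndependentIn.B⊆S inS , (λ x∈ → subst (_∈ S) (sym (x∈⁅y⁆⇒x≡y j x∈)) j∈S) ]
                     ∘ x∈p∪q⁻ B ⁅ j ⁆
             ; independent = ind }
      , inj₁ (x∈p∪q⁺ (inj₂ (x∈⁅x⁆ j)))
    ... | yes _   | no dep  = inS , inj₂ (inj₂ dep)
    ... | no j∉S  | _       = inS , inj₂ (inj₁ j∉S)

    greedy : Subset n → List (Fin n) → Subset n → Subset n
    greedy S []       B = B
    greedy S (j ∷ js) B = greedy S js (add S B j)

    greedy-⊇ : ∀ S js B → B ⊆ greedy S js B
    greedy-⊇ S []       B = id
    greedy-⊇ S (j ∷ js) B = greedy-⊇ S js (add S B j) ∘ add-⊇ S B j

    greedy-spec : ∀ S js B → IndependentIn S B →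
                  IndependentIn S (greedy S js B) × (∀ j → j ∈ₗ js → NotAddable S (greedy S js B) j)
    greedy-spec S []       B inS = inS , λ _ ()
    greedy-spec S (j ∷ js) B inS with add-spec S B j inS
    ... | inS′ , j-done with greedy-spec S js (add S B j) inS′
    ...   | inS″ , js-done = inS″ , λ
      { _ (here refl)  → notAddable-mono (greedy-⊇ S js (add S B j)) j j-done
      ; j′ (there j′∈) → js-done j′ j′∈ }

  basis : ∀ S → ∃ (IsBasis S)
  basis S with greedy-spec S (allFin n) ⊥ ⊥-independentIn
    where
    ⊥-independentIn : IndependentIn S ⊥
    ⊥-independentIn = record { B⊆S = ⊥-elim ∘ ∉⊥ ; independent = λ a sa _ i → sa i ∉⊥ }
  ... | record { B⊆S = B⊆S ; independent = ind } , done =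
    B , record { B⊆S = B⊆S ; independent = ind ; circuit = circuit }
    where
    B : Subset n
    B = greedy S (allFin n) ⊥
    circuit : ∀ j → j ∈ S ─ B → ∃ λ c → Codeword c × SupportedIn (B ∪ ⁅ j ⁆) c × c j ≡ 1#
    circuit j j∈S─B with done j (∈-allFin j)
    ... | inj₁ j∈B         = ⊥-elim (x∈p─q⇒x∉q S B j∈S─B j∈B)
    ... | inj₂ (inj₁ j∉S)  = ⊥-elim (j∉S (p─q⊆p S B j∈S─B))
    ... | inj₂ (inj₂ dep)  = fundamentalCircuit B j ind dep

  -- A codeword supported in S is determined by its values off the independent set T.
  count-codewordsIn-≤ : ∀ {S T} → T ⊆ S → Indep h T → count (codewordsIn S) ≤ q ^ ∣ S ─ T ∣
  count-codewordsIn-≤ {S} {T} T⊆S ind = ℕ.≤-trans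
    (count-≤-injection (codewordsIn S) (everything ∣ U ∣) (compress U) (λ _ _ → tt) injective)
    (ℕ.≤-reflexive (count-everything ∣ U ∣))
    where
    U : Subset n
    U = S ─ T
    injective : ∀ v w → Holds (codewordsIn S) v → Holds (codewordsIn S) w →
                compress U v ≈V compress U w → v ≈V w
    injective v w (cv , sv) (cw , sw) e i =
      x-y≡0⇒x≡y (v i) (w i) (ind _ difference-in-T (codeword-sub cv cw) i)
      where
      difference-in-T : SupportedIn T (λ j → v j + - w j)
      difference-in-T j j∉T with j ∈? S
      ... | yes j∈S = begin
        v j + - w j ≡⟨ cong (_+ - w j) (trans (sym (expand-compress U v j j∈U))
                                        (trans (expand-cong U e j) (expand-compress U w j j∈U))) ⟩
        w j + - w j ≡⟨ -‿inverseʳ (w j) ⟩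
        0#          ∎
        where
        j∈U : j ∈ U
        j∈U = x∈p∧x∉q⇒x∈p─q j∈S j∉T
      ... | no j∉S = begin
        v j + - w j ≡⟨ cong₂ (λ a b → a + - b) (sv j j∉S) (sw j j∉S) ⟩
        0# + - 0#   ≡⟨ -‿inverseʳ 0# ⟩
        0#          ∎

  -- Combining the fundamental circuits with arbitrary coefficients gives q ^ ∣ S ─ B ∣ distinct codewords.
  count-codewordsIn-≥ : ∀ {S B} → IsBasis S B → q ^ ∣ S ─ B ∣ ≤ count (codewordsIn S)
  count-codewordsIn-≥ {S} {B} isBasis = subst (_≤ count (codewordsIn S)) (count-everything ∣ U ∣)
    (count-≤-injection (everything ∣ U ∣) (codewordsIn S) combination
      (λ w _ → codeword-combination (expand U w) circuitAt circuitAt-codeword , combination-supportedIn w)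
      (λ w w′ _ _ → combination-injective w w′))
    where
    open IsBasis isBasis
    U : Subset n
    U = S ─ B

    circuitAt : Fin n → Vect n
    circuitAt j with j ∈? U
    ... | yes j∈U = proj₁ (circuit j j∈U)
    ... | no _    = λ _ → 0#

    circuitAt-codeword : ∀ j → Codeword (circuitAt j)
    circuitAt-codeword j with j ∈? U
    ... | yes j∈U = proj₁ (proj₂ (circuit j j∈U))
    ... | no _    = codeword-zero

    circuitAt-supportedIn : ∀ j → SupportedIn S (circuitAt j)
    circuitAt-supportedIn j i i∉S with j ∈? U
    ... | yes j∈U = proj₁ (proj₂ (proj₂ (circuit j j∈U))) i
      ([ i∉S ∘ B⊆S , (λ i∈⁅j⁆ → i∉S (subst (_∈ S) (sym (x∈⁅y⁆⇒x≡y j i∈⁅j⁆)) (p─q⊆p S B j∈U))) ]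
       ∘ x∈p∪q⁻ B ⁅ j ⁆)
    ... | no _    = refl

    circuitAt-offDiagonal : ∀ j i → i ∈ U → j ≢ i → circuitAt j i ≡ 0#
    circuitAt-offDiagonal j i i∈U j≢i with j ∈? U
    ... | yes j∈U = proj₁ (proj₂ (proj₂ (circuit j j∈U))) i
      ([ x∈p─q⇒x∉q S B i∈U , (λ i∈⁅j⁆ → j≢i (sym (x∈⁅y⁆⇒x≡y j i∈⁅j⁆))) ] ∘ x∈p∪q⁻ B ⁅ j ⁆)
    ... | no _    = refl

    circuitAt-diagonal : ∀ i → i ∈ U → circuitAt i i ≡ 1#
    circuitAt-diagonal i i∈U with i ∈? U
    ... | yes i∈U′ = proj₂ (proj₂ (proj₂ (circuit i i∈U′)))
    ... | no i∉U   = ⊥-elim (i∉U i∈U)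

    combination : Vect ∣ U ∣ → Vect n
    combination w i = sumF n (λ j → expand U w j * circuitAt j i)

    combination-supportedIn : ∀ w → SupportedIn S (combination w)
    combination-supportedIn w i i∉S =
      sumF-zero n (λ j → trans (cong (expand U w j *_) (circuitAt-supportedIn j i i∉S)) (zeroʳ _))

    combination-on-U : ∀ w i → i ∈ U → combination w i ≡ expand U w i
    combination-on-U w i i∈U = begin
      combination w i               ≡⟨ sumF-single n _ i (λ j j≢i → trans
                                         (cong (expand U w j *_) (circuitAt-offDiagonal j i i∈U j≢i)) (zeroʳ _)) ⟩
      expand U w i * circuitAt i i  ≡⟨ cong (expand U w i *_) (circuitAt-diagonal i i∈U) ⟩
      expand U w i * 1#             ≡⟨ *-identityʳ _ ⟩
      expand U w i                  ∎

    combination-injective : ∀ w w′ → combination w ≈V combination w′ → w ≈V w′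
    combination-injective w w′ e t =
      trans (sym (compress-expand U w t)) (trans (compress-cong U expand-≈ t) (compress-expand U w′ t))
      where
      expand-≈ : expand U w ≈V expand U w′
      expand-≈ i with i ∈? U
      ... | yes i∈U = trans (sym (combination-on-U w i i∈U)) (trans (e i) (combination-on-U w′ i i∈U))
      ... | no i∉U  = trans (expand-∉ U w i i∉U) (sym (expand-∉ U w′ i i∉U))

  count-codewordsIn-basis : ∀ {S B} → IsBasis S B → count (codewordsIn S) ≡ q ^ ∣ S ─ B ∣
  count-codewordsIn-basis isBasis =
    ℕ.≤-antisym (count-codewordsIn-≤ (IsBasis.B⊆S isBasis) (IsBasis.independent isBasis))
                (count-codewordsIn-≥ isBasis)

  basis-hasRank : ∀ {S B} → IsBasis S B → HasRank h S ∣ B ∣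
  basis-hasRank {S} {B} isBasis = (B , B⊆S , independent , refl) , maximum
    where
    open IsBasis isBasis
    maximum : ∀ T → T ⊆ S → Indep h T → ∣ T ∣ ≤ ∣ B ∣
    maximum T T⊆S indT = ℕ.+-cancelˡ-≤ ∣ S ─ B ∣ _ _ (ℕ.≤-trans (ℕ.+-monoˡ-≤ ∣ T ∣ S─B≤S─T)
      (ℕ.≤-reflexive (trans (sym (∣p∣≡∣p─q∣+∣q∣ S T T⊆S)) (∣p∣≡∣p─q∣+∣q∣ S B B⊆S))))
      where
      S─B≤S─T : ∣ S ─ B ∣ ≤ ∣ S ─ T ∣
      S─B≤S─T = q^-reflects-≤ (subst (_≤ q ^ ∣ S ─ T ∣) (count-codewordsIn-basis isBasis)
                                    (count-codewordsIn-≤ T⊆S indT))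

  hasRank-unique : ∀ {S k k′} → HasRank h S k → HasRank h S k′ → k ≡ k′
  hasRank-unique ((T , T⊆S , indT , ∣T∣≡k) , maxk) ((T′ , T′⊆S , indT′ , ∣T′∣≡k′) , maxk′) =
    ℕ.≤-antisym (subst (_≤ _) ∣T∣≡k (maxk′ T T⊆S indT)) (subst (_≤ _) ∣T′∣≡k′ (maxk T′ T′⊆S indT′))

  nullity⇒count : ∀ {S i} → HasNullity h S i → count (codewordsIn S) ≡ q ^ i
  nullity⇒count {S} {i} (k , rank , ∣S∣≡k+i) with basis S
  ... | B , isBasis = trans (count-codewordsIn-basis isBasis) (cong (q ^_) ∣S─B∣≡i)
    where
    ∣S─B∣≡i : ∣ S ─ B ∣ ≡ i
    ∣S─B∣≡i = ℕ.+-cancelʳ-≡ ∣ B ∣ _ _ (begin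
      ∣ S ─ B ∣ +ℕ ∣ B ∣  ≡⟨ sym (∣p∣≡∣p─q∣+∣q∣ S B (IsBasis.B⊆S isBasis)) ⟩
      ∣ S ∣               ≡⟨ ∣S∣≡k+i ⟩
      k +ℕ i              ≡⟨ cong (_+ℕ i) (hasRank-unique rank (basis-hasRank isBasis)) ⟩
      ∣ B ∣ +ℕ i          ≡⟨ ℕ.+-comm ∣ B ∣ i ⟩
      i +ℕ ∣ B ∣          ∎)

  count⇒nullity : ∀ {S i} → count (codewordsIn S) ≡ q ^ i → HasNullity h S i
  count⇒nullity {S} {i} #≡q^i with basis S
  ... | B , isBasis = ∣ B ∣ , basis-hasRank isBasis , (begin
    ∣ S ∣               ≡⟨ ∣p∣≡∣p─q∣+∣q∣ S B (IsBasis.B⊆S isBasis) ⟩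
    ∣ S ─ B ∣ +ℕ ∣ B ∣  ≡⟨ cong (_+ℕ ∣ B ∣) ∣S─B∣≡i ⟩
    i +ℕ ∣ B ∣          ≡⟨ ℕ.+-comm i ∣ B ∣ ⟩
    ∣ B ∣ +ℕ i          ∎)
    where
    ∣S─B∣≡i : ∣ S ─ B ∣ ≡ i
    ∣S─B∣≡i = q^-injective (trans (sym (count-codewordsIn-basis isBasis)) #≡q^i)

  -- S is a union of circuits.
  Covered : Subset n → Set
  Covered S = ∀ j → j ∈ S → ∃ (Holds ((codewordsIn S) nonzeroAt j))

  codewordsIn-mono : ∀ {R S} → R ⊆ S → ∀ c → Holds (codewordsIn R) c → Holds (codewordsIn S) c
  codewordsIn-mono R⊆S c (cc , sc) = cc , λ i i∉S → sc i (i∉S ∘ R⊆S)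

  -- If every codeword supported in S vanished at j, then S ─ ⁅ j ⁆ would carry the same codewords, hence
  -- the same nullity.
  minimal⇒covered : ∀ {S i} → MinimalNullity h i S → Covered S
  minimal⇒covered {S} {i} (nullS , minimal) j j∈S with search ((codewordsIn S) nonzeroAt j)
  ... | yes witness = witness
  ... | no none     = ⊥-elim (x∈p─q⇒x∉q S ⁅ j ⁆ (subst (j ∈_) (sym S─j≡S) j∈S) (x∈⁅x⁆ j))
    where
    S─j⊆S : S ─ ⁅ j ⁆ ⊆ S
    S─j⊆S = p─q⊆p S ⁅ j ⁆

    supportedIn-S─j : ∀ c → Holds (codewordsIn S) c → SupportedIn (S ─ ⁅ j ⁆) c
    supportedIn-S─j c cS i i∉S─j with i Fin.≟ j
    ... | yes refl = vanishes-without-witness (codewordsIn S) none c cS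
    ... | no i≢j   with i ∈? S
    ...   | yes i∈S = ⊥-elim (i∉S─j (x∈p∧x∉q⇒x∈p─q i∈S (x≢y⇒x∉⁅y⁆ i≢j)))
    ...   | no i∉S  = proj₂ cS i i∉S

    S─j≡S : S ─ ⁅ j ⁆ ≡ S
    S─j≡S = minimal (S ─ ⁅ j ⁆) S─j⊆S (count⇒nullity (trans
      (count-cong (codewordsIn (S ─ ⁅ j ⁆)) (codewordsIn S) (codewordsIn-mono S─j⊆S)
                  (λ c cS → proj₁ cS , supportedIn-S─j c cS))
      (nullity⇒count nullS)))

  covered⇒minimal : ∀ {S i} → HasNullity h S i → Covered S → MinimalNullity h i S
  covered⇒minimal {S} {i} nullS covered = nullS , λ R R⊆S nullR → ⊆-antisym R⊆S (S⊆R R⊆S nullR)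
    where
    S⊆R : ∀ {R} → R ⊆ S → HasNullity h R i → S ⊆ R
    S⊆R {R} R⊆S nullR {j} j∈S with j ∈? R
    ... | yes j∈R = j∈R
    ... | no j∉R with covered j j∈S
    ...   | c , cS , cj≢0 = ⊥-elim (cj≢0 (proj₂ (codewords-agree c cS) j j∉R))
      where
      codewords-agree : ∀ c → Holds (codewordsIn S) c → Holds (codewordsIn R) c
      codewords-agree = count-≡⇒⊇ (codewordsIn R) (codewordsIn S) (codewordsIn-mono R⊆S)
                                  (trans (nullity⇒count nullR) (sym (nullity⇒count nullS)))

module CommutativeRingIdentities (R : CommutativeRing 0ℓ 0ℓ) where

  open import Data.Maybe using (nothing)
  open import Tactic.RingSolver using (solve-∀)
  open import Tactic.RingSolver.Core.AlmostCommutativeRing using (AlmostCommutativeRing; fromCommutativeRing)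

  private
    ring : AlmostCommutativeRing 0ℓ 0ℓ
    ring = fromCommutativeRing R (λ _ → nothing)

  open AlmostCommutativeRing ring

  horner-addTerm : ∀ a b t P E → a + t * (b * P + E) ≈ b * (t * P) + (a + t * E)
  horner-addTerm = solve-∀ ring

  horner-divide : ∀ a u p Q E → a + (u + p) * (u * Q + E) ≈ u * (E + (u + p) * Q) + (a + p * E)
  horner-divide = solve-∀ ring

module UnivariatePolynomials {q : ℕ} (𝔽 : FiniteField q) where

  open import Data.Nat using (pred)
  import Data.Nat.Properties as ℕ
  open import Data.List using (List; []; _∷_; length; map; allFin)
  import Data.List.Properties as List
  open import Data.List.Relation.Unary.All using (All; []; _∷_; tabulate)
  open import Data.List.Relation.Unary.Unique.Propositional using (Unique)
  import Data.List.Relation.Unary.Unique.Propositional.Properties as Unique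
  open import Data.List.Relation.Unary.AllPairs using ([]; _∷_)
  open FieldProperties 𝔽
  open ≡-Reasoning

  -- Coefficient lists, constant term first.
  Coefficients : Set
  Coefficients = List Carrier

  eval : Coefficients → Carrier → Carrier
  eval []       t = 0#
  eval (a ∷ as) t = a + t * eval as t

  coefficient : ℕ → Coefficients → Carrier
  coefficient s       []       = 0#
  coefficient zero    (a ∷ as) = a
  coefficient (suc s) (a ∷ as) = coefficient s as

  AllZero : Coefficients → Set
  AllZero = All (_≡ 0#)

  coefficient-allZero : ∀ s as → AllZero as → coefficient s as ≡ 0#
  coefficient-allZero s       []       _        = refl
  coefficient-allZero zero    (a ∷ as) (a≡0 ∷ _) = a≡0
  coefficient-allZero (suc s) (a ∷ as) (_ ∷ as≡0) = coefficient-allZero s as as≡0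

  addTerm : Carrier → ℕ → Coefficients → Coefficients
  addTerm b zero    []       = b ∷ []
  addTerm b zero    (a ∷ as) = (b + a) ∷ as
  addTerm b (suc s) []       = 0# ∷ addTerm b s []
  addTerm b (suc s) (a ∷ as) = a ∷ addTerm b s as

  open CommutativeRingIdentities commutativeRing

  eval-addTerm : ∀ b s as t → eval (addTerm b s as) t ≡ b * pow t s + eval as t
  eval-addTerm b zero    []       t =
    trans (cong (b +_) (zeroʳ t)) (trans (+-identityʳ b) (sym (trans (+-identityʳ _) (*-identityʳ b))))
  eval-addTerm b zero    (a ∷ as) t = trans (+-assoc b a _) (cong (_+ (a + t * eval as t)) (sym (*-identityʳ b)))
  eval-addTerm b (suc s) []       t = begin
    0# + t * eval (addTerm b s []) t  ≡⟨ cong (λ e → 0# + t * e) (eval-addTerm b s [] t) ⟩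
    0# + t * (b * pow t s + 0#)       ≡⟨ horner-addTerm 0# b t (pow t s) 0# ⟩
    b * (t * pow t s) + (0# + t * 0#) ≡⟨ cong (b * (t * pow t s) +_) (trans (+-identityˡ _) (zeroʳ t)) ⟩
    b * (t * pow t s) + 0#            ∎
  eval-addTerm b (suc s) (a ∷ as) t =
    trans (cong (λ e → a + t * e) (eval-addTerm b s as t)) (horner-addTerm a b t (pow t s) (eval as t))

  length-addTerm : ∀ b s as {N} → length as ≤ N → s < N → length (addTerm b s as) ≤ N
  length-addTerm b zero    []       _          s<N       = s<N
  length-addTerm b zero    (a ∷ as) ∣as∣≤N     _         = ∣as∣≤N
  length-addTerm b (suc s) []       _          (s≤s s<N) = s≤s (length-addTerm b s [] z≤n s<N)
  length-addTerm b (suc s) (a ∷ as) (s≤s ∣as∣≤N) (s≤s s<N) = s≤s (length-addTerm b s as ∣as∣≤N s<N)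

  coefficient-addTerm-same : ∀ b s as j → j ≡ s → coefficient j (addTerm b s as) ≡ b + coefficient j as
  coefficient-addTerm-same b zero    []       _ refl = sym (+-identityʳ b)
  coefficient-addTerm-same b zero    (a ∷ as) _ refl = refl
  coefficient-addTerm-same b (suc s) []       _ refl = coefficient-addTerm-same b s [] s refl
  coefficient-addTerm-same b (suc s) (a ∷ as) _ refl = coefficient-addTerm-same b s as s refl

  coefficient-addTerm-other : ∀ b s as j → j ≢ s → coefficient j (addTerm b s as) ≡ coefficient j as
  coefficient-addTerm-other b zero    []       zero    j≢s = ⊥-elim (j≢s refl)
  coefficient-addTerm-other b zero    []       (suc j) _   = refl
  coefficient-addTerm-other b zero    (a ∷ as) zero    j≢s = ⊥-elim (j≢s refl)
  coefficient-addTerm-other b zero    (a ∷ as) (suc j) _   = refl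
  coefficient-addTerm-other b (suc s) []       zero    _   = refl
  coefficient-addTerm-other b (suc s) []       (suc j) j≢s = coefficient-addTerm-other b s [] j (j≢s ∘ cong suc)
  coefficient-addTerm-other b (suc s) (a ∷ as) zero    _   = refl
  coefficient-addTerm-other b (suc s) (a ∷ as) (suc j) j≢s = coefficient-addTerm-other b s as j (j≢s ∘ cong suc)

  -- Synthetic division by t − p; the remainder is eval as p.
  divide : Carrier → Coefficients → Coefficients
  divide p []           = []
  divide p (a ∷ [])     = []
  divide p (a ∷ b ∷ as) = eval (b ∷ as) p ∷ divide p (b ∷ as)

  length-divide : ∀ p as → length (divide p as) ≡ pred (length as)
  length-divide p []           = refl
  length-divide p (a ∷ [])     = refl
  length-divide p (a ∷ b ∷ as) = cong suc (length-divide p (b ∷ as))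

  eval-divide : ∀ p as t → eval as t ≡ (t + - p) * eval (divide p as) t + eval as p
  eval-divide p []           t = sym (trans (cong (_+ 0#) (zeroʳ _)) (+-identityˡ 0#))
  eval-divide p (a ∷ [])     t =
    trans (cong (a +_) (zeroʳ t)) (sym (trans (cong₂ _+_ (zeroʳ _) (cong (a +_) (zeroʳ p))) (+-identityˡ _)))
  eval-divide p (a ∷ b ∷ as) t = begin
    a + t * eval (b ∷ as) t            ≡⟨ cong (λ e → a + t * e) (eval-divide p (b ∷ as) t) ⟩
    a + t * (u * Q + E)                ≡⟨ cong (λ x → a + x * (u * Q + E)) t≡u+p ⟩
    a + (u + p) * (u * Q + E)          ≡⟨ horner-divide a u p Q E ⟩
    u * (E + (u + p) * Q) + (a + p * E) ≡⟨ cong (λ x → u * (E + x * Q) + (a + p * E)) (sym t≡u+p) ⟩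
    u * (E + t * Q) + (a + p * E)      ∎
    where
    u Q E : Carrier
    u = t + - p
    Q = eval (divide p (b ∷ as)) t
    E = eval (b ∷ as) p
    t≡u+p : t ≡ u + p
    t≡u+p = sym (trans (+-assoc t (- p) p) (trans (cong (t +_) (-‿inverseˡ p)) (+-identityʳ t)))

  divide-allZero : ∀ p as → AllZero (divide p as) → eval as p ≡ 0# → AllZero as
  divide-allZero p []           _              _    = []
  divide-allZero p (a ∷ [])     _              ev≡0 =
    trans (sym (trans (cong (a +_) (zeroʳ p)) (+-identityʳ a))) ev≡0 ∷ []
  divide-allZero p (a ∷ b ∷ as) (E≡0 ∷ quot≡0) ev≡0 =
    trans (sym (trans (cong (λ e → a + p * e) E≡0) (trans (cong (a +_) (zeroʳ p)) (+-identityʳ a)))) ev≡0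
    ∷ divide-allZero p (b ∷ as) quot≡0 E≡0

  allZero-of-roots : ∀ ps → Unique ps → ∀ as → length as ≤ length ps →
                     All (λ p → eval as p ≡ 0#) ps → AllZero as
  allZero-of-roots []       _               []       _            _                  = []
  allZero-of-roots (p ∷ ps) _               []       _            _                  = []
  allZero-of-roots (p ∷ ps) (p∉ps ∷ unique) (a ∷ as) (s≤s ∣as∣≤) (root-p ∷ roots-ps) =
    divide-allZero p (a ∷ as)
      (allZero-of-roots ps unique (divide p (a ∷ as))
        (subst (_≤ length ps) (sym (length-divide p (a ∷ as))) ∣as∣≤)
        (roots-of-quotient ps p∉ps roots-ps))
      root-p
    where
    quotient : Coefficients
    quotient = divide p (a ∷ as)
    roots-of-quotient : ∀ xs → All (p ≢_) xs → All (λ x → eval (a ∷ as) x ≡ 0#) xs →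
                        All (λ x → eval quotient x ≡ 0#) xs
    roots-of-quotient []       _             _               = []
    roots-of-quotient (x ∷ xs) (p≢x ∷ p∉xs) (root-x ∷ roots) =
      xy≡0⇒y≡0 (λ x-p≡0 → p≢x (sym (x-y≡0⇒x≡y x p x-p≡0))) (begin
        (x + - p) * eval quotient x                    ≡⟨ sym (+-identityʳ _) ⟩
        (x + - p) * eval quotient x + 0#               ≡⟨ cong ((x + - p) * eval quotient x +_) (sym root-p) ⟩
        (x + - p) * eval quotient x + eval (a ∷ as) p  ≡⟨ sym (eval-divide p (a ∷ as) x) ⟩
        eval (a ∷ as) x                                ≡⟨ root-x ⟩
        0#                                             ∎)
      ∷ roots-of-quotient xs p∉xs roots

  vanishing⇒allZero : ∀ as → length as ≤ q → (∀ t → eval as t ≡ 0#) → AllZero as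
  vanishing⇒allZero as ∣as∣≤q vanishes =
    allZero-of-roots elements elements-unique as (subst (length as ≤_) (sym elements-length) ∣as∣≤q)
      (tabulate (λ {t} _ → vanishes t))
    where
    elements : List Carrier
    elements = map toF (allFin q)
    elements-unique : Unique elements
    elements-unique = Unique.map⁺ toF-injective (Unique.allFin⁺ q)
    elements-length : length elements ≡ q
    elements-length = trans (List.length-map toF (allFin q)) (List.length-tabulate id)

module Homogenization {q : ℕ} (𝔽 : FiniteField q) where

  open import Data.Nat renaming (_+_ to _+ℕ_) using ()
  import Data.Nat.Properties as ℕ
  open import Algebra.Properties.CommutativeSemigroup ℕ.+-commutativeSemigroup
    using () renaming (x∙yz≈y∙xz to ℕ+-left-commute)
  open import Data.Fin using (punchIn)
  open import Data.Vec.Functional using (insertAt)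
  open import Data.Vec.Functional.Properties using (insertAt-lookup; insertAt-punchIn)
  open import Data.List using ([]; _∷_; length; map)
  open import Data.List.Relation.Unary.All using ([]; _∷_)
  open FieldProperties 𝔽
  open UnivariatePolynomials 𝔽
  open ≡-Reasoning

  monomial : ∀ {nv} → (Fin nv → ℕ) → Vect nv → Carrier
  monomial e x = prodF _ (λ k → pow (x k) (e k))

  prodF-cong : ∀ nv {f g : Fin nv → Carrier} → (∀ i → f i ≡ g i) → prodF nv f ≡ prodF nv g
  prodF-cong zero     _ = refl
  prodF-cong (suc nv) e = cong₂ _*_ (e zero) (prodF-cong nv (e ∘ suc))

  degM-cong : ∀ nv {e e′ : Fin nv → ℕ} → (∀ i → e i ≡ e′ i) → degM e ≡ degM e′
  degM-cong zero     _  = refl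
  degM-cong (suc nv) e≗ = cong₂ _+ℕ_ (e≗ zero) (degM-cong nv (e≗ ∘ suc))

  prodF-punchIn : ∀ m (H : Fin (suc m)) (f : Fin (suc m) → Carrier) →
                  prodF (suc m) f ≡ f H * prodF m (f ∘ punchIn H)
  prodF-punchIn m       zero    f = refl
  prodF-punchIn (suc m) (suc H) f =
    trans (cong (f zero *_) (prodF-punchIn m H (f ∘ suc))) (*-left-commute (f zero) (f (suc H)) _)

  degM-punchIn : ∀ m (H : Fin (suc m)) (e : Fin (suc m) → ℕ) → degM e ≡ e H +ℕ degM (e ∘ punchIn H)
  degM-punchIn m       zero    e = refl
  degM-punchIn (suc m) (suc H) e =
    trans (cong (e zero +ℕ_) (degM-punchIn m H (e ∘ suc))) (ℕ+-left-commute (e zero) (e (suc H)) _)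

  pow-1# : ∀ k → pow 1# k ≡ 1#
  pow-1# zero    = refl
  pow-1# (suc k) = trans (cong (1# *_) (pow-1# k)) (*-identityˡ 1#)

  pow-* : ∀ x y k → pow (x * y) k ≡ pow x k * pow y k
  pow-* x y zero    = sym (*-identityˡ 1#)
  pow-* x y (suc k) = trans (cong ((x * y) *_) (pow-* x y k)) (*-interchange x y _ _)

  pow-+ : ∀ x a b → pow x (a +ℕ b) ≡ pow x a * pow x b
  pow-+ x zero    b = sym (*-identityˡ _)
  pow-+ x (suc a) b = trans (cong (x *_) (pow-+ x a b)) (sym (*-assoc x _ _))

  monomial-punchIn : ∀ {m} (H : Fin (suc m)) e x →
                     monomial e x ≡ pow (x H) (e H) * monomial (e ∘ punchIn H) (deleteAt H x)
  monomial-punchIn {m} H e x = prodF-punchIn m H (λ k → pow (x k) (e k))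

  monomial-cong : ∀ {nv} {e e′ : Fin nv → ℕ} {x y} → (∀ i → e i ≡ e′ i) → x ≈V y →
                  monomial e x ≡ monomial e′ y
  monomial-cong {nv} e≗ x≈y = prodF-cong nv (λ k → cong₂ pow (x≈y k) (e≗ k))

  monomial-scale : ∀ {nv} (e : Fin nv → ℕ) t x → monomial e (λ k → t * x k) ≡ pow t (degM e) * monomial e x
  monomial-scale {zero}   e t x = sym (*-identityʳ 1#)
  monomial-scale {suc nv} e t x = begin
    pow (t * x zero) (e zero) * monomial (e ∘ suc) (λ k → t * x (suc k))
      ≡⟨ cong₂ _*_ (pow-* t (x zero) (e zero)) (monomial-scale (e ∘ suc) t (x ∘ suc)) ⟩
    (pow t (e zero) * pow (x zero) (e zero)) * (pow t (degM (e ∘ suc)) * monomial (e ∘ suc) (x ∘ suc))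
      ≡⟨ *-interchange _ _ _ _ ⟩
    (pow t (e zero) * pow t (degM (e ∘ suc))) * (pow (x zero) (e zero) * monomial (e ∘ suc) (x ∘ suc))
      ≡⟨ cong (_* _) (sym (pow-+ t (e zero) _)) ⟩
    pow t (degM e) * monomial e x ∎

  evalPoly-cong : ∀ {nv} (f : Poly nv) {x y : Vect nv} → x ≈V y → evalPoly f x ≡ evalPoly f y
  evalPoly-cong []            x≈y = refl
  evalPoly-cong ((c , e) ∷ f) x≈y =
    cong₂ _+_ (cong (c *_) (monomial-cong {e = e} (λ _ → refl) x≈y)) (evalPoly-cong f x≈y)

  module _ {m : ℕ} (H : Fin (suc m)) where

    homogenize : ℕ → Poly m → Poly (suc m)
    homogenize d = map λ (c , e) → c , insertAt e H (d ∸ degM e)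

    dehomogenize : Poly (suc m) → Poly m
    dehomogenize = map λ (c , e) → c , e ∘ punchIn H

    degM-insertAt : ∀ e k → degM (insertAt e H k) ≡ k +ℕ degM e
    degM-insertAt e k = trans (degM-punchIn m H (insertAt e H k))
      (cong₂ _+ℕ_ (insertAt-lookup e H k) (degM-cong m (insertAt-punchIn e H k)))

    homogenize-homogeneous : ∀ d g → DegreeAtMost d g → Homogeneous d (homogenize d g)
    homogenize-homogeneous d []            []             = []
    homogenize-homogeneous d ((c , e) ∷ g) (deg≤d ∷ degs) =
      trans (degM-insertAt e (d ∸ degM e)) (ℕ.m∸n+n≡m deg≤d) ∷ homogenize-homogeneous d g degs

    homogenize-eval : ∀ d g x → x H ≡ 1# → evalPoly (homogenize d g) x ≡ evalPoly g (deleteAt H x)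
    homogenize-eval d []            x xH≡1 = refl
    homogenize-eval d ((c , e) ∷ g) x xH≡1 = cong₂ _+_ (cong (c *_) (begin
      monomial (insertAt e H k) x
        ≡⟨ monomial-punchIn H (insertAt e H k) x ⟩
      pow (x H) (insertAt e H k H) * monomial (insertAt e H k ∘ punchIn H) (deleteAt H x)
        ≡⟨ cong₂ _*_ (trans (cong₂ pow xH≡1 (insertAt-lookup e H k)) (pow-1# k))
                     (monomial-cong (insertAt-punchIn e H k) (λ _ → refl)) ⟩
      1# * monomial e (deleteAt H x)
        ≡⟨ *-identityˡ _ ⟩
      monomial e (deleteAt H x) ∎)) (homogenize-eval d g x xH≡1)
      where
      k : ℕ
      k = d ∸ degM e

    degM-punchIn-≤ : ∀ d e → degM e ≡ d → degM (e ∘ punchIn H) ≤ d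
    degM-punchIn-≤ d e deg≡d = subst (degM (e ∘ punchIn H) ≤_) (trans (sym (degM-punchIn m H e)) deg≡d)
                                     (ℕ.m≤n+m _ (e H))

    dehomogenize-degree : ∀ d f → Homogeneous d f → DegreeAtMost d (dehomogenize f)
    dehomogenize-degree d []            []             = []
    dehomogenize-degree d ((c , e) ∷ f) (deg≡d ∷ degs) = degM-punchIn-≤ d e deg≡d ∷ dehomogenize-degree d f degs

    dehomogenize-eval : ∀ f x → x H ≡ 1# → evalPoly f x ≡ evalPoly (dehomogenize f) (deleteAt H x)
    dehomogenize-eval []            x xH≡1 = refl
    dehomogenize-eval ((c , e) ∷ f) x xH≡1 = cong₂ _+_ (cong (c *_) (begin
      monomial e x
        ≡⟨ monomial-punchIn H e x ⟩
      pow (x H) (e H) * monomial (e ∘ punchIn H) (deleteAt H x)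
        ≡⟨ cong (_* monomial (e ∘ punchIn H) (deleteAt H x)) (trans (cong (λ w → pow w (e H)) xH≡1) (pow-1# (e H))) ⟩
      1# * monomial (e ∘ punchIn H) (deleteAt H x)
        ≡⟨ *-identityˡ _ ⟩
      monomial (e ∘ punchIn H) (deleteAt H x) ∎)) (dehomogenize-eval f x xH≡1)

    -- The point e_H + t y of the line through e_H in direction y.
    line : Vect (suc m) → Carrier → Vect (suc m)
    line y t = insertAt (λ k → t * y (punchIn H k)) H 1#

    alongLine : Poly (suc m) → Vect (suc m) → Coefficients
    alongLine []            y = []
    alongLine ((c , e) ∷ f) y =
      addTerm (c * monomial (e ∘ punchIn H) (deleteAt H y)) (degM (e ∘ punchIn H)) (alongLine f y)

    monomial-line : ∀ e y t →
                    monomial e (line y t) ≡ pow t (degM (e ∘ punchIn H)) * monomial (e ∘ punchIn H) (deleteAt H y)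
    monomial-line e y t = begin
      monomial e (line y t)
        ≡⟨ monomial-punchIn H e (line y t) ⟩
      pow (line y t H) (e H) * monomial (e ∘ punchIn H) (deleteAt H (line y t))
        ≡⟨ cong₂ _*_ (trans (cong (λ w → pow w (e H)) (insertAt-lookup _ H 1#)) (pow-1# (e H)))
                     (monomial-cong {e = e ∘ punchIn H} (λ _ → refl) (insertAt-punchIn _ H 1#)) ⟩
      1# * monomial (e ∘ punchIn H) (λ k → t * y (punchIn H k))
        ≡⟨ trans (*-identityˡ _) (monomial-scale (e ∘ punchIn H) t (deleteAt H y)) ⟩
      pow t (degM (e ∘ punchIn H)) * monomial (e ∘ punchIn H) (deleteAt H y) ∎

    eval-alongLine : ∀ f y t → eval (alongLine f y) t ≡ evalPoly f (line y t)
    eval-alongLine []            y t = refl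
    eval-alongLine ((c , e) ∷ f) y t = begin
      eval (addTerm (c * M) D (alongLine f y)) t  ≡⟨ eval-addTerm (c * M) D (alongLine f y) t ⟩
      c * M * pow t D + eval (alongLine f y) t    ≡⟨ cong₂ _+_ (trans (*-assoc c M _) (cong (c *_) (*-comm M _)))
                                                               (eval-alongLine f y t) ⟩
      c * (pow t D * M) + F                       ≡⟨ cong (λ z → c * z + F) (sym (monomial-line e y t)) ⟩
      c * monomial e (line y t) + F               ∎
      where
      F : Carrier
      F = evalPoly f (line y t)
      M : Carrier
      M = monomial (e ∘ punchIn H) (deleteAt H y)
      D : ℕ
      D = degM (e ∘ punchIn H)

    length-alongLine : ∀ d f y → Homogeneous d f → length (alongLine f y) ≤ suc d
    length-alongLine d []            y []             = z≤n
    length-alongLine d ((c , e) ∷ f) y (deg≡d ∷ degs) =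
      length-addTerm _ _ (alongLine f y) (length-alongLine d f y degs) (s≤s (degM-punchIn-≤ d e deg≡d))

    monomial-free-of-x_H : ∀ e y → e H ≡ 0 → monomial e y ≡ monomial (e ∘ punchIn H) (deleteAt H y)
    monomial-free-of-x_H e y eH≡0 =
      trans (monomial-punchIn H e y) (trans (cong (λ k → pow (y H) k * M) eH≡0) (*-identityˡ M))
      where
      M : Carrier
      M = monomial (e ∘ punchIn H) (deleteAt H y)

    monomial-divisible-by-x_H : ∀ e y {k} → e H ≡ suc k → y H ≡ 0# → monomial e y ≡ 0#
    monomial-divisible-by-x_H e y {k} eH≡1+k yH≡0 = begin
      monomial e y                   ≡⟨ monomial-punchIn H e y ⟩
      pow (y H) (e H) * M            ≡⟨ cong₂ (λ z j → pow z j * M) yH≡0 eH≡1+k ⟩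
      (0# * pow 0# k) * M            ≡⟨ trans (cong (_* M) (zeroˡ _)) (zeroˡ M) ⟩
      0#                             ∎
      where
      M : Carrier
      M = monomial (e ∘ punchIn H) (deleteAt H y)

    -- Since y H ≡ 0, only the monomials free of x_H survive in f y, and they are exactly those
    -- contributing to the top coefficient tᵈ.
    coefficient-alongLine : ∀ d f y → Homogeneous d f → y H ≡ 0# → coefficient d (alongLine f y) ≡ evalPoly f y
    coefficient-alongLine d []            y []             _    = refl
    coefficient-alongLine d ((c , e) ∷ f) y (deg≡d ∷ degs) yH≡0 with e H in eH≡ | degM-punchIn m H e
    ... | zero  | deg≡D = begin
      coefficient d (addTerm (c * M) D (alongLine f y))  ≡⟨ coefficient-addTerm-same (c * M) D _ d d≡D ⟩
      c * M + coefficient d (alongLine f y)              ≡⟨ cong₂ _+_ (cong (c *_) (sym (monomial-free-of-x_H e y eH≡)))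
                                                                      (coefficient-alongLine d f y degs yH≡0) ⟩
      c * monomial e y + evalPoly f y                    ∎
      where
      M : Carrier
      M = monomial (e ∘ punchIn H) (deleteAt H y)
      D : ℕ
      D = degM (e ∘ punchIn H)
      d≡D : d ≡ D
      d≡D = trans (sym deg≡d) deg≡D
    ... | suc k | deg≡1+k+D = begin
      coefficient d (addTerm (c * M) D (alongLine f y))  ≡⟨ coefficient-addTerm-other (c * M) D _ d d≢D ⟩
      coefficient d (alongLine f y)                      ≡⟨ coefficient-alongLine d f y degs yH≡0 ⟩
      evalPoly f y                                       ≡⟨ sym (+-identityˡ _) ⟩
      0# + evalPoly f y                                  ≡⟨ cong (_+ evalPoly f y) (sym c*monomial≡0) ⟩
      c * monomial e y + evalPoly f y                    ∎
      where
      M : Carrier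
      M = monomial (e ∘ punchIn H) (deleteAt H y)
      D : ℕ
      D = degM (e ∘ punchIn H)
      d≢D : d ≢ D
      d≢D d≡D = ℕ.m≢1+n+m D (trans (sym d≡D) (trans (sym deg≡d) deg≡1+k+D))
      c*monomial≡0 : c * monomial e y ≡ 0#
      c*monomial≡0 = trans (cong (c *_) (monomial-divisible-by-x_H e y eH≡ yH≡0)) (zeroʳ c)

    -- The restriction of f to the line is a polynomial of degree ≤ d < q vanishing on all of 𝔽,
    -- so its coefficients vanish, in particular the top one, which is f y.
    vanishing-on-line : ∀ d f y → Homogeneous d f → d < q → y H ≡ 0# →
                        (∀ t → evalPoly f (line y t) ≡ 0#) → evalPoly f y ≡ 0#
    vanishing-on-line d f y homogeneous d<q yH≡0 vanishes = begin
      evalPoly f y                    ≡⟨ sym (coefficient-alongLine d f y homogeneous yH≡0) ⟩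
      coefficient d (alongLine f y)   ≡⟨ coefficient-allZero d _ (vanishing⇒allZero (alongLine f y)
                                           (ℕ.≤-trans (length-alongLine d f y homogeneous) d<q)
                                           (λ t → trans (eval-alongLine f y t) (vanishes t))) ⟩
      0#                              ∎

module ReedMullerCodes {q : ℕ} (𝔽 : FiniteField q) where

  open import Data.Nat.Properties using (≤-antisym)
  open import Data.Vec.Functional.Properties using (insertAt-lookup)
  import Data.Fin.Properties as Fin
  open import Data.Fin.Subset.Properties using (_∈?_; x∈p⇒x∉∁p; x∉∁p⇒x∈p; x∉p⇒x∈∁p; x∈∁p⇒x∉p)
  open import Data.Product using (proj₁; proj₂)
  open import Relation.Nullary using (Dec; yes; no)
  open import Relation.Nullary.Decidable using (¬?; _×-dec_; _→-dec_)
  open FieldProperties 𝔽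
  open Homogenization 𝔽
  open SubsetProperties

  module AffineChart (m d : ℕ) (d<q : d < q) (H : Fin (suc m))
    (n₁ : ℕ) (pts : Fin n₁ → Vect (suc m)) (representatives : IsProjRepresentatives pts)
    (normalized : ∀ j → ¬ (pts j H ≡ 0#) → pts j H ≡ 1#)
    (n₂ : ℕ) (emb : Fin n₂ → Fin n₁)
    (emb-affine : ∀ k → ¬ (pts (emb k) H ≡ 0#))
    (emb-onto-affine : ∀ j → ¬ (pts j H ≡ 0#) → ∃ λ k → emb k ≡ j)
    {r₁ : ℕ} (h₁ : Fin r₁ → Vect n₁) (parityCheck₁ : IsParityCheck (PRM d pts) r₁ h₁)
    {r₂ : ℕ} (h₂ : Fin r₂ → Vect n₂)
    (parityCheck₂ : IsParityCheck (RM d (λ k → deleteAt H (pts (emb k)))) r₂ h₂)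
    where

    module M₁ = VectorMatroid 𝔽 h₁
    module M₂ = VectorMatroid 𝔽 h₂

    restrict : Vect n₁ → Vect n₂
    restrict c k = c (emb k)

    restrict-codeword : ∀ c → M₁.Codeword c → M₂.Codeword (restrict c)
    restrict-codeword c cc with M₁.codeword⇒parityCheck parityCheck₁ c cc
    ... | f , homogeneous , c≡f = M₂.parityCheck⇒codeword parityCheck₂ (restrict c)
      ( dehomogenize H f , dehomogenize-degree H d f homogeneous
      , λ k → trans (c≡f (emb k)) (dehomogenize-eval H f (pts (emb k)) (normalized _ (emb-affine k))))

    extend : Vect n₂ → Vect n₁
    extend c with M₂.codeword? c
    ... | yes cc = λ j → evalPoly (homogenize H d (proj₁ (M₂.codeword⇒parityCheck parityCheck₂ c cc))) (pts j)
    ... | no _   = λ _ → 0#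

    extend-codeword : ∀ c → M₁.Codeword (extend c)
    extend-codeword c with M₂.codeword? c
    ... | yes cc = M₁.parityCheck⇒codeword parityCheck₁ _
      (_ , homogenize-homogeneous H d _ (proj₁ (proj₂ (M₂.codeword⇒parityCheck parityCheck₂ c cc))) , λ _ → refl)
    ... | no _   = M₁.codeword-zero

    restrict-extend : ∀ c → M₂.Codeword c → restrict (extend c) ≈V c
    restrict-extend c cc′ k with M₂.codeword? c
    ... | yes cc with M₂.codeword⇒parityCheck parityCheck₂ c cc
    ...   | g , _ , c≡g = trans (homogenize-eval H d g (pts (emb k)) (normalized _ (emb-affine k))) (sym (c≡g k))
    restrict-extend c cc′ k | no ¬cc = ⊥-elim (¬cc cc′)

    representative-of-normalized : ∀ v → v H ≡ 1# → ∃ λ j → ¬ pts j H ≡ 0# × v ≈V pts j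
    representative-of-normalized v vH≡1
      with proj₂ representatives v (H , λ vH≡0 → 0≢1 (trans (sym vH≡0) vH≡1))
    ... | j , (λ′ , _ , v≡λ′pts) , _ =
      j , affine , λ k → trans (v≡λ′pts k) (trans (cong (_* pts j k) λ′≡1) (*-identityˡ _))
      where
      1≡λ′ptsH : 1# ≡ λ′ * pts j H
      1≡λ′ptsH = trans (sym vH≡1) (v≡λ′pts H)
      affine : ¬ pts j H ≡ 0#
      affine ptsH≡0 = 0≢1 (sym (trans 1≡λ′ptsH (trans (cong (λ′ *_) ptsH≡0) (zeroʳ λ′))))
      λ′≡1 : λ′ ≡ 1#
      λ′≡1 = trans (sym (*-identityʳ λ′)) (trans (cong (λ′ *_) (sym (normalized j affine))) (sym 1≡λ′ptsH))

    -- A point y at infinity lies on the line through e_H in direction y, whose other points are affine.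
    vanishes-off-affine : ∀ c → M₁.Codeword c → (∀ k → c (emb k) ≡ 0#) → ∀ j → c j ≡ 0#
    vanishes-off-affine c cc c∘emb≡0 = vanishes
      where
      vanishes-at-affine : ∀ j → ¬ pts j H ≡ 0# → c j ≡ 0#
      vanishes-at-affine j affine with emb-onto-affine j affine
      ... | k , refl = c∘emb≡0 k

      vanishes : ∀ j → c j ≡ 0#
      vanishes j with pts j H ≟ 0# | M₁.codeword⇒parityCheck parityCheck₁ c cc
      ... | no affine      | _                     = vanishes-at-affine j affine
      ... | yes atInfinity | f , homogeneous , c≡f =
        trans (c≡f j) (vanishing-on-line H d f (pts j) homogeneous d<q atInfinity f-on-line)
        where
        f-on-line : ∀ t → evalPoly f (line H (pts j) t) ≡ 0#
        f-on-line t with representative-of-normalized (line H (pts j) t) (insertAt-lookup _ H 1#)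
        ... | j′ , affine , line≈pts =
          trans (evalPoly-cong f line≈pts) (trans (sym (c≡f j′)) (vanishes-at-affine j′ affine))

    restrict-injective : ∀ c c′ → M₁.Codeword c → M₁.Codeword c′ → restrict c ≈V restrict c′ → c ≈V c′
    restrict-injective c c′ cc cc′ c≈c′ j =
      x-y≡0⇒x≡y (c j) (c′ j) (vanishes-off-affine _ (M₁.codeword-sub cc cc′) difference-vanishes j)
      where
      difference-vanishes : ∀ k → c (emb k) + - c′ (emb k) ≡ 0#
      difference-vanishes k = trans (cong (λ z → c (emb k) + - z) (sym (c≈c′ k))) (-‿inverseʳ (c (emb k)))

    module _ (σ : Subset n₂) where

      vanishingOn-σ : VecPred n₁
      vanishingOn-σ = record
        { Holds    = λ c → M₁.Codeword c × (∀ k → k ∈ σ → c (emb k) ≡ 0#)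
        ; holds?   = λ c → M₁.codeword? c ×-dec Fin.all? (λ k → k ∈? σ →-dec (c (emb k) ≟ 0#))
        ; respects = λ { v≈w (cv , v≡0) →
                           M₁.codeword-cong v≈w cv , λ k k∈σ → trans (sym (v≈w (emb k))) (v≡0 k k∈σ) }
        }

      OutsideSupports : Fin n₁ → Set
      OutsideSupports j = ¬ ∃ (Holds (vanishingOn-σ nonzeroAt j))

      outsideSupports? : ∀ j → Dec (OutsideSupports j)
      outsideSupports? j = ¬? (search (vanishingOn-σ nonzeroAt j))

      -- E₁ ∖ τ is the union of the supports of the codewords vanishing on σ.
      τ : Subset n₁
      τ = fromPredicate outsideSupports?

      σ⊆τ : ∀ k → k ∈ σ → emb k ∈ τ
      σ⊆τ k k∈σ = ∈fromPredicate⁺ outsideSupports? λ (c , (_ , c≡0) , c≢0) → c≢0 (c≡0 k k∈σ)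

      codewordsIn-∁τ⇒vanishingOn-σ : ∀ c → Holds (M₁.codewordsIn (∁ τ)) c → Holds vanishingOn-σ c
      codewordsIn-∁τ⇒vanishingOn-σ c (cc , sc) = cc , λ k k∈σ → sc (emb k) (x∈p⇒x∉∁p (σ⊆τ k k∈σ))

      vanishingOn-σ⇒codewordsIn-∁τ : ∀ c → Holds vanishingOn-σ c → Holds (M₁.codewordsIn (∁ τ)) c
      vanishingOn-σ⇒codewordsIn-∁τ c cσ = proj₁ cσ , λ j j∉∁τ →
        vanishes-without-witness vanishingOn-σ (∈fromPredicate⁻ outsideSupports? (x∉∁p⇒x∈p j∉∁τ)) c cσ

      extend-vanishingOn-σ : ∀ c → Holds (M₂.codewordsIn (∁ σ)) c → Holds vanishingOn-σ (extend c)
      extend-vanishingOn-σ c (cc , sc) =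
        extend-codeword c , λ k k∈σ → trans (restrict-extend c cc k) (sc k (x∈p⇒x∉∁p k∈σ))

      count-∁τ≡count-∁σ : count (M₁.codewordsIn (∁ τ)) ≡ count (M₂.codewordsIn (∁ σ))
      count-∁τ≡count-∁σ = ≤-antisym
        (count-≤-injection (M₁.codewordsIn (∁ τ)) (M₂.codewordsIn (∁ σ)) restrict
          (λ c c∁τ → let (cc , c≡0) = codewordsIn-∁τ⇒vanishingOn-σ c c∁τ in
                     restrict-codeword c cc , λ k k∉∁σ → c≡0 k (x∉∁p⇒x∈p k∉∁σ))
          (λ c c′ c∁τ c′∁τ → restrict-injective c c′ (proj₁ c∁τ) (proj₁ c′∁τ)))
        (count-≤-injection (M₂.codewordsIn (∁ σ)) (M₁.codewordsIn (∁ τ)) extend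
          (λ c c∁σ → vanishingOn-σ⇒codewordsIn-∁τ (extend c) (extend-vanishingOn-σ c c∁σ))
          (λ c c′ (cc , _) (cc′ , _) e k → trans (sym (restrict-extend c cc k))
                                             (trans (e (emb k)) (restrict-extend c′ cc′ k))))

      module _ {i : ℕ} (minimal-∁σ : MinimalNullity h₂ i (∁ σ)) where

        ∁τ-nullity : HasNullity h₁ (∁ τ) i
        ∁τ-nullity = M₁.count⇒nullity (trans count-∁τ≡count-∁σ (M₂.nullity⇒count (proj₁ minimal-∁σ)))

        ∁τ-covered : M₁.Covered (∁ τ)
        ∁τ-covered j j∈∁τ with search (vanishingOn-σ nonzeroAt j)
        ... | yes (c , cσ , cj≢0) = c , vanishingOn-σ⇒codewordsIn-∁τ c cσ , cj≢0
        ... | no none             = ⊥-elim (x∈∁p⇒x∉p j∈∁τ (∈fromPredicate⁺ outsideSupports? none))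

        ∁τ-minimal : MinimalNullity h₁ i (∁ τ)
        ∁τ-minimal = M₁.covered⇒minimal ∁τ-nullity ∁τ-covered

        τ⊆σ : ∀ k → emb k ∈ τ → k ∈ σ
        τ⊆σ k embk∈τ with k ∈? σ
        ... | yes k∈σ = k∈σ
        ... | no k∉σ with M₂.minimal⇒covered minimal-∁σ k (x∉p⇒x∈∁p k∉σ)
        ...   | c , c∁σ , ck≢0 = ⊥-elim (∈fromPredicate⁻ outsideSupports? embk∈τ
          (extend c , extend-vanishingOn-σ c c∁σ , ck≢0 ∘ trans (sym (restrict-extend c (proj₁ c∁σ) k))))

propositionA4 : ∀ {q : ℕ} (𝔽 : FiniteField q) → let open FieldDefs 𝔽 in
    ∀ (m d : ℕ) → d < q →
    ∀ (H : Fin (suc m)) →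
    ∀ (n₁ : ℕ) (pts : Fin n₁ → Vect (suc m)) →
    IsProjRepresentatives pts →
    (∀ j → ¬ (pts j H ≡ 0#) → pts j H ≡ 1#) →
    ∀ (n₂ : ℕ) (emb : Fin n₂ → Fin n₁) →
    Injective _≡_ _≡_ emb →
    (∀ k → ¬ (pts (emb k) H ≡ 0#)) →
    (∀ j → ¬ (pts j H ≡ 0#) → ∃ λ k → emb k ≡ j) →
    ∀ (r₁ : ℕ) (h₁ : Fin r₁ → Vect n₁) →
    IsParityCheck (PRM d pts) r₁ h₁ →
    ∀ (r₂ : ℕ) (h₂ : Fin r₂ → Vect n₂) →
    IsParityCheck (RM d (λ k → deleteAt H (pts (emb k)))) r₂ h₂ →
    ∀ (i : ℕ) → 1 ≤ i → (∀ k → HasRank h₂ ⊤ k → i ≤ n₂ ∸ k) →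
    ∀ (σ : Subset n₂) → MinimalNullity h₂ i (∁ σ) →
    ∃ λ (τ : Subset n₁) → MinimalNullity h₁ i (∁ τ)
    × (∀ k → (emb k ∈ τ → k ∈ σ) × (k ∈ σ → emb k ∈ τ))
propositionA4 𝔽 m d d<q H n₁ pts representatives normalized n₂ emb _ emb-affine emb-onto-affine
              r₁ h₁ parityCheck₁ r₂ h₂ parityCheck₂ i _ _ σ minimal-∁σ =
  τ σ , ∁τ-minimal σ minimal-∁σ , λ k → τ⊆σ σ minimal-∁σ k , σ⊆τ σ k
  where
  open ReedMullerCodes.AffineChart 𝔽 m d d<q H n₁ pts representatives normalized n₂ emb emb-affine emb-onto-affine
                                   h₁ parityCheck₁ h₂ parityCheck₂
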